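{- Let $n\ge 5$ and $T_n=comb(Gir_5,n-4)\in RB_U(n)$. Then $\pi_5(p_{T_n})$ is a vertex of the polytope $EX_5^n$.
   Context: $RB_L(k)$ denotes the set of rooted binary trees (every non-leaf vertex has exactly two unordered children) with $k$ leaves labelled bijectively by $[k]$, up to label-preserving isomorphism; $RB_U(k)$ the set of unlabelled shapes. $Comb_k$ is the shape in which every non-leaf vertex has a leaf child. $Bal_4$ is the 4-leaf shape whose root's two children each have two leaf children. $Gir_5$ is the 5-leaf shape whose root has one leaf child and whose other root child is the root of a copy of $Bal_4$. For a shape $T$ with $m$ leaves and $k\ge 2$, $comb(T,k)$ is the tree with $m+k-1$ leaves obtained from $Comb_k$ by replacing one of the two leaves at the deepest level with $T$; $comb(T,1)=T$. For $T\in RB_U(k)$, $p_T$ is the distribution on $RB_L(k)$ uniform on labelled trees of shape $T$. For a tree $Q$ and a set $A$ of its leaves, $Q|_A$ is the restriction tree (vertices: elements of $A$ and lowest common ancestors of pairs of them, ancestry inherited from $Q$). Exchangeable = invariant under relabelling leaves; $EX_k$ = exchangeable distributions on $RB_L(k)$. $\pi_5(p)(S)=\sum_{\{Q\in RB_L(n): Q|_{[5]}=S\}}p(Q)$ and $EX_5^n=\pi_5(EX_n)\subseteq\mathbb{R}^{RB_L(5)}$, a polytope.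
   Formalization: The polytope $EX_5^n$ is taken over the rationals: its points have rational coordinates, the exchangeable distributions have rational weights, and the convex combinations in the vertex test have rational coefficients. -}

module Defs where

open import Data.Nat as ℕ using (ℕ; zero; suc; _∸_; _!; _<?_)
open import Data.Nat.Properties using (_!≢0)
open import Data.Fin using (Fin; toℕ; fromℕ<)
open import Data.Fin.Properties as FinP using ()
open import Data.Fin.Permutation using (Permutation′; _⟨$⟩ʳ_)
open import Data.Bool using (Bool; true; false; _∧_; _∨_; if_then_else_)
open import Data.List using (List; []; _∷_; _++_; map; concatMap; foldr; allFin; mapMaybe)
open import Data.List.Relation.Binary.Permutation.Propositional using (_↭_)
open import Data.Maybe using (Maybe; just; nothing)
open import Data.Product using (_×_; _,_; Σ; proj₁; proj₂)
open import Data.Integer using (+_)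
open import Data.Rational using (ℚ; 0ℚ; 1ℚ; _+_; _*_; _-_; _/_; _≤_; _<_)
open import Data.List.Relation.Unary.All using (All)
open import Relation.Binary.PropositionalEquality using (_≡_)
open import Relation.Nullary.Decidable using (⌊_⌋; yes; no)

-- Rooted binary trees with leaves labelled in A (children are ordered
-- in the data type; unorderedness is handled by the isomorphism test).

data Tree (A : Set) : Set where
  leaf : A → Tree A
  node : Tree A → Tree A → Tree A

leaves : ∀ {A} → Tree A → List A
leaves (leaf a)   = a ∷ []
leaves (node l r) = leaves l ++ leaves r

mapTree : ∀ {A B : Set} → (A → B) → Tree A → Tree B
mapTree f (leaf a)   = leaf (f a)
mapTree f (node l r) = node (mapTree f l) (mapTree f r)

-- A labelled tree with k leaves labelled bijectively by [k] = Fin k: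
-- an element of RB_L(k) (up to isomorphism, see _≅ᵇ_).
ValidL : (k : ℕ) → Tree (Fin k) → Set
ValidL k t = leaves t ↭ allFin k

_≅ᵇ_ : ∀ {k} → Tree (Fin k) → Tree (Fin k) → Bool
leaf a   ≅ᵇ leaf b     = ⌊ a FinP.≟ b ⌋
leaf _   ≅ᵇ node _ _   = false
node _ _ ≅ᵇ leaf _     = false
node l r ≅ᵇ node l' r' = ((l ≅ᵇ l') ∧ (r ≅ᵇ r')) ∨ ((l ≅ᵇ r') ∧ (r ≅ᵇ l'))

-- Vertices of the restriction tree are the kept leaves and the lowest
-- common ancestors of pairs of them; this is exactly suppressing the
-- removed leaves and the resulting unary vertices.

restrict5 : ∀ {n} → Tree (Fin n) → Maybe (Tree (Fin 5))
restrict5 (leaf a) with toℕ a <? 5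
... | yes p = just (leaf (fromℕ< p))
... | no _  = nothing
restrict5 (node l r) with restrict5 l | restrict5 r
... | just l' | just r' = just (node l' r')
... | just l' | nothing = just l'
... | nothing | just r' = just r'
... | nothing | nothing = nothing

restrictIs : ∀ {n} → Tree (Fin n) → Tree (Fin 5) → Bool
restrictIs Q S with restrict5 Q
... | just S' = S' ≅ᵇ S
... | nothing = false

-- Finitely supported (rational) distributions on RB_L(n), given as a
-- list of weighted labelled trees; the probability of a tree is the
-- total weight of the entries isomorphic to it.

sumℚ : List ℚ → ℚ
sumℚ = foldr _+_ 0ℚ

WList : ℕ → Set
WList n = List (Tree (Fin n) × ℚ)

mass : ∀ {n} → WList n → Tree (Fin n) → ℚ
mass D Q = sumℚ (map (λ e → if proj₁ e ≅ᵇ Q then proj₂ e else 0ℚ) D)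

π5 : ∀ {n} → WList n → Tree (Fin 5) → ℚ
π5 D S = sumℚ (map (λ e → if restrictIs (proj₁ e) S then proj₂ e else 0ℚ) D)

IsDistribution : (n : ℕ) → WList n → Set
IsDistribution n D =
  All (λ e → ValidL n (proj₁ e)) D ×
  All (λ e → 0ℚ ≤ proj₂ e) D ×
  sumℚ (map proj₂ D) ≡ 1ℚ

Exchangeable : (n : ℕ) → WList n → Set
Exchangeable n D = (σ : Permutation′ n) (Q : Tree (Fin n)) → ValidL n Q →
  mass D (mapTree (σ ⟨$⟩ʳ_) Q) ≡ mass D Q

Point : Set
Point = Tree (Fin 5) → ℚ

_≈ₚ_ : Point → Point → Set
x ≈ₚ y = (S : Tree (Fin 5)) → ValidL 5 S → x S ≡ y S

EX5 : ℕ → Point → Set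
EX5 n x = Σ (WList n) λ D → IsDistribution n D × Exchangeable n D × (x ≈ₚ π5 D)

IsVertex : (Point → Set) → Point → Set
IsVertex P v = P v ×
  ((x y : Point) (λ' : ℚ) → P x → P y → 0ℚ < λ' → λ' < 1ℚ →
   ((S : Tree (Fin 5)) → ValidL 5 S → v S ≡ λ' * x S + (1ℚ - λ') * y S) →
   (x ≈ₚ v) × (y ≈ₚ v))

data Shape : Set where
  lf : Shape
  nd : Shape → Shape → Shape

Bal4 : Shape
Bal4 = nd (nd lf lf) (nd lf lf)

Gir5 : Shape
Gir5 = nd lf Bal4

-- comb(T,1) = T, comb(T,k+1) = root with a leaf child and comb(T,k)
-- (Comb_{k+1} is a leaf joined with Comb_k at the root, and the deepest
-- leaves of Comb_{k+1}, k ≥ 2, lie inside that Comb_k; comb(T,0) is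
-- not used and is set to T).
comb : Shape → ℕ → Shape
comb T zero          = T
comb T (suc zero)    = T
comb T (suc (suc k)) = nd lf (comb T (suc k))

labelGo : ∀ {A : Set} → Shape → List A → Maybe (Tree A × List A)
labelGo lf [] = nothing
labelGo lf (a ∷ as) = just (leaf a , as)
labelGo (nd s t) as with labelGo s as
... | nothing = nothing
... | just (l , as') with labelGo t as'
...   | nothing = nothing
...   | just (r , as'') = just (node l r , as'')

labelShape : ∀ {A : Set} → Shape → List A → Maybe (Tree A)
labelShape s as with labelGo s as
... | just (t , []) = just t
... | _ = nothing

insertAll : ∀ {A : Set} → A → List A → List (List A)
insertAll a [] = (a ∷ []) ∷ []
insertAll a (b ∷ bs) = (a ∷ b ∷ bs) ∷ map (b ∷_) (insertAll a bs)

perms : ∀ {A : Set} → List A → List (List A)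
perms [] = [] ∷ []
perms (a ∷ as) = concatMap (insertAll a) (perms as)

-- p_T : uniform distribution on the labelled trees of shape T, given as
-- the n! labellings of T (one per bijection leaves → [n]), each of
-- weight 1/n!; every labelled tree of shape T occurs |Aut(T)| times.
pShape : (n : ℕ) → Shape → WList n
pShape n T = mapMaybe (λ π → Data.Maybe.map (λ t → (t , (+ 1 / (n !)) {{n !≢0}})) (labelShape T π))
                      (perms (allFin n))
  where import Data.Maybe

Tn : ℕ → Shape
Tn n = comb Gir5 (n ∸ 4)

-- Call a vertex wide when its two subtrees carry at least 2 and at least 3 leaves. A tree with
-- no wide vertex is a caterpillar (shape Comb_n) or a caterpillar ending in Bal4 (shape T_n),
-- while a wide vertex survives in some restriction to five leaves. No restriction of T_n is wide,
-- so if π5(p_{T_n}) = λ π5(p) + (1 - λ) π5(q) with p, q exchangeable and 0 < λ < 1, then p and q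
-- give no mass to trees with a wide vertex; by exchangeability each of them is then, on the
-- level of π5, a mixture α π5(p_{Comb_n}) + β π5(p_{T_n}). A five-leaf restriction G of T_n that
-- keeps its Bal4 is not a caterpillar, so π5(p_{Comb_n})(G) = 0 < π5(p_{T_n})(G), and evaluating
-- the convex combination at G forces α = 0 for both p and q.

module Submission where

open import Defs

module Combinatorics where

  open import Data.Nat as ℕ using (ℕ; zero; suc; _+_; _*_; _∸_; _!; _≤_; _<?_; _≤?_; z≤n; s≤s)
  import Data.Nat.Properties as ℕP
  open import Data.Fin as Fin using (Fin; toℕ; fromℕ<)
  import Data.Fin.Properties as FinP
  open import Data.Fin.Permutation as Perm using (Permutation′; _⟨$⟩ʳ_; _⟨$⟩ˡ_; _∘ₚ_; inverseˡ; inverseʳ)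
  import Data.Fin.Permutation.Components as PermC
  open import Data.Bool using (true; false; T)
  open import Data.Bool.Properties using (T-∧; T-∨)
  open import Data.List using (List; []; _∷_; _++_; map; mapMaybe; concatMap; length; take; allFin; tabulate)
  import Data.List.Properties as ListP
  open import Data.List.Relation.Unary.All as All using (All; []; _∷_)
  import Data.List.Relation.Unary.All.Properties as AllP
  open import Data.List.Relation.Unary.Any using (here; there)
  open import Data.List.Relation.Unary.Unique.Propositional using (Unique; []; _∷_)
  import Data.List.Relation.Unary.Unique.Propositional.Properties as UniqueP
  open import Data.List.Membership.Propositional using (_∈_; _∉_)
  import Data.List.Membership.Propositional.Properties as ∈P
  open import Data.List.Membership.Propositional.Properties.WithK using (unique∧set⇒bag)
  open import Data.List.Relation.Binary.Permutation.Propositional as ↭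
    using (_↭_; ↭-refl; ↭-sym; ↭-trans; ↭⇒↭ₛ; module PermutationReasoning)
  import Data.List.Relation.Binary.Permutation.Propositional.Properties as ↭P
  import Data.List.Relation.Binary.Permutation.Setoid.Properties as ↭ₛP
  open import Data.List.Relation.Binary.BagAndSetEquality using (∼bag⇒↭)
  open import Data.List.Relation.Binary.Sublist.Propositional using (_⊆_; []; _∷_; _∷ʳ_; ⊆-refl)
  open import Data.List.Relation.Binary.Sublist.Propositional.Properties using (++⁺; ++⁺ˡ; ++⁺ʳ)
  open import Data.List.Relation.Binary.Sublist.Heterogeneous.Properties using (take-Sublist)
  open import Data.Maybe as Maybe using (Maybe; just; nothing; maybe′)
  import Data.Maybe.Properties as MaybeP
  open import Data.Maybe.Relation.Unary.All using (just; nothing) renaming (All to Allᵐ)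
  open import Data.Maybe.Relation.Unary.Any using (just) renaming (Any to Anyᵐ)
  open import Data.Maybe.Relation.Binary.Pointwise using (Pointwise; just; nothing)
  open import Data.Product using (_×_; _,_; ∃; ∃₂; proj₁; proj₂)
  open import Data.Sum using (_⊎_; inj₁; inj₂)
  open import Data.Empty using (⊥-elim)
  open import Function using (_∘_; Equivalence; mk⇔)
  open import Relation.Binary.PropositionalEquality as ≡ using (_≡_; _≢_; refl; sym; trans; cong; cong₂; subst; subst₂)
  open import Relation.Nullary using (¬_; Dec; yes; no; _×-dec_; _⊎-dec_)
  open import Relation.Nullary.Reflects using (Reflects; ofʸ; ofⁿ; fromEquivalence)
  open import Relation.Nullary.Decidable using (toWitness; fromWitness)

  private variable
    A B C : Set

  -- Trees up to isomorphism

  size : Tree A → ℕ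
  size (leaf _)   = 1
  size (node l r) = size l + size r

  size≡length-leaves : (t : Tree A) → size t ≡ length (leaves t)
  size≡length-leaves (leaf _)   = refl
  size≡length-leaves (node l r) =
    trans (cong₂ _+_ (size≡length-leaves l) (size≡length-leaves r)) (sym (ListP.length-++ (leaves l)))

  1≤size : (t : Tree A) → 1 ≤ size t
  1≤size (leaf _)   = s≤s z≤n
  1≤size (node l r) = ℕP.≤-trans (1≤size l) (ℕP.m≤m+n (size l) (size r))

  mapTree-∘ : (g : B → C) (f : A → B) (t : Tree A) → mapTree g (mapTree f t) ≡ mapTree (g ∘ f) t
  mapTree-∘ g f (leaf a)   = refl
  mapTree-∘ g f (node l r) = cong₂ node (mapTree-∘ g f l) (mapTree-∘ g f r)

  mapTree-id : (f : A → A) → (∀ a → f a ≡ a) → (t : Tree A) → mapTree f t ≡ t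
  mapTree-id f f≗id (leaf a)   = cong leaf (f≗id a)
  mapTree-id f f≗id (node l r) = cong₂ node (mapTree-id f f≗id l) (mapTree-id f f≗id r)

  infix 4 _≅_

  data _≅_ {A : Set} : Tree A → Tree A → Set where
    leaf≅ : ∀ {a} → leaf a ≅ leaf a
    node≅ : ∀ {l r l′ r′} → l ≅ l′ → r ≅ r′ → node l r ≅ node l′ r′
    swap≅ : ∀ {l r l′ r′} → l ≅ r′ → r ≅ l′ → node l r ≅ node l′ r′

  ≅-refl : (t : Tree A) → t ≅ t
  ≅-refl (leaf a)   = leaf≅
  ≅-refl (node l r) = node≅ (≅-refl l) (≅-refl r)

  ≅-sym : {t u : Tree A} → t ≅ u → u ≅ t
  ≅-sym leaf≅       = leaf≅
  ≅-sym (node≅ p q) = node≅ (≅-sym p) (≅-sym q)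
  ≅-sym (swap≅ p q) = swap≅ (≅-sym q) (≅-sym p)

  ≅-trans : {t u v : Tree A} → t ≅ u → u ≅ v → t ≅ v
  ≅-trans leaf≅       leaf≅         = leaf≅
  ≅-trans (node≅ p q) (node≅ p′ q′) = node≅ (≅-trans p p′) (≅-trans q q′)
  ≅-trans (node≅ p q) (swap≅ p′ q′) = swap≅ (≅-trans p p′) (≅-trans q q′)
  ≅-trans (swap≅ p q) (node≅ p′ q′) = swap≅ (≅-trans p q′) (≅-trans q p′)
  ≅-trans (swap≅ p q) (swap≅ p′ q′) = node≅ (≅-trans p q′) (≅-trans q p′)

  size-≅ : {t u : Tree A} → t ≅ u → size t ≡ size u
  size-≅ leaf≅                      = refl
  size-≅ (node≅ p q)                = cong₂ _+_ (size-≅ p) (size-≅ q)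
  size-≅ (swap≅ {l′ = l′} {r′} p q) = trans (cong₂ _+_ (size-≅ p) (size-≅ q)) (ℕP.+-comm (size r′) (size l′))

  ≅⇒leaves-↭ : {t u : Tree A} → t ≅ u → leaves t ↭ leaves u
  ≅⇒leaves-↭ leaf≅                      = ↭-refl
  ≅⇒leaves-↭ (node≅ p q)                = ↭P.++⁺ (≅⇒leaves-↭ p) (≅⇒leaves-↭ q)
  ≅⇒leaves-↭ (swap≅ {l′ = l′} {r′} p q) = ↭-trans (↭P.++⁺ (≅⇒leaves-↭ p) (≅⇒leaves-↭ q)) (↭P.++-comm (leaves r′) (leaves l′))

  mapTree-≅ : (f : A → B) {t u : Tree A} → t ≅ u → mapTree f t ≅ mapTree f u
  mapTree-≅ f leaf≅       = leaf≅
  mapTree-≅ f (node≅ p q) = node≅ (mapTree-≅ f p) (mapTree-≅ f q)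
  mapTree-≅ f (swap≅ p q) = swap≅ (mapTree-≅ f p) (mapTree-≅ f q)

  module _ {k : ℕ} where

    ≅ᵇ-sound : (t u : Tree (Fin k)) → T (t ≅ᵇ u) → t ≅ u
    ≅ᵇ-sound (leaf a) (leaf b) h with refl ← toWitness {a? = a FinP.≟ b} h = leaf≅
    ≅ᵇ-sound (node l r) (node l′ r′) h with Equivalence.to T-∨ h
    ... | inj₁ h′ = let p , q = Equivalence.to T-∧ h′ in node≅ (≅ᵇ-sound l l′ p) (≅ᵇ-sound r r′ q)
    ... | inj₂ h′ = let p , q = Equivalence.to T-∧ h′ in swap≅ (≅ᵇ-sound l r′ p) (≅ᵇ-sound r l′ q)

    ≅ᵇ-complete : {t u : Tree (Fin k)} → t ≅ u → T (t ≅ᵇ u)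
    ≅ᵇ-complete (leaf≅ {a}) = fromWitness {a? = a FinP.≟ a} refl
    ≅ᵇ-complete (node≅ p q) = Equivalence.from T-∨ (inj₁ (Equivalence.from T-∧ (≅ᵇ-complete p , ≅ᵇ-complete q)))
    ≅ᵇ-complete (swap≅ p q) = Equivalence.from T-∨ (inj₂ (Equivalence.from T-∧ (≅ᵇ-complete p , ≅ᵇ-complete q)))

    ≅ᵇ-reflects : (t u : Tree (Fin k)) → Reflects (t ≅ u) (t ≅ᵇ u)
    ≅ᵇ-reflects t u = fromEquivalence (≅ᵇ-sound t u) ≅ᵇ-complete

    ≅ᵇ-cong : {t t′ u u′ : Tree (Fin k)} → t ≅ t′ → u ≅ u′ → (t ≅ᵇ u) ≡ (t′ ≅ᵇ u′)
    ≅ᵇ-cong {t} {t′} {u} {u′} p q with t ≅ᵇ u | ≅ᵇ-reflects t u | t′ ≅ᵇ u′ | ≅ᵇ-reflects t′ u′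
    ... | true  | _      | true  | _      = refl
    ... | false | _      | false | _      = refl
    ... | true  | ofʸ h  | false | ofⁿ ¬h = ⊥-elim (¬h (≅-trans (≅-sym p) (≅-trans h q)))
    ... | false | ofⁿ ¬h | true  | ofʸ h  = ⊥-elim (¬h (≅-trans p (≅-trans h (≅-sym q))))

  infixr 5 _⊕_

  _⊕_ : Maybe (Tree A) → Maybe (Tree A) → Maybe (Tree A)
  just l  ⊕ just r  = just (node l r)
  just l  ⊕ nothing = just l
  nothing ⊕ r       = r

  restrictBy : (A → Maybe B) → Tree A → Maybe (Tree B)
  restrictBy g (leaf a)   = Maybe.map leaf (g a)
  restrictBy g (node l r) = restrictBy g l ⊕ restrictBy g r

  inFin5 : ∀ {n} → Fin n → Maybe (Fin 5)
  inFin5 a with toℕ a <? 5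
  ... | yes a<5 = just (fromℕ< a<5)
  ... | no _    = nothing

  restrict5-node : ∀ {n} (l r : Tree (Fin n)) → restrict5 (node l r) ≡ restrict5 l ⊕ restrict5 r
  restrict5-node l r with restrict5 l | restrict5 r
  ... | just _  | just _  = refl
  ... | just _  | nothing = refl
  ... | nothing | just _  = refl
  ... | nothing | nothing = refl

  restrict5≡restrictBy : ∀ {n} (t : Tree (Fin n)) → restrict5 t ≡ restrictBy inFin5 t
  restrict5≡restrictBy (leaf a) with toℕ a <? 5
  ... | yes _ = refl
  ... | no _  = refl
  restrict5≡restrictBy (node l r) =
    trans (restrict5-node l r) (cong₂ _⊕_ (restrict5≡restrictBy l) (restrict5≡restrictBy r))

  restrictBy-mapTree : (g : B → Maybe C) (f : A → B) (t : Tree A) →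
                       restrictBy g (mapTree f t) ≡ restrictBy (g ∘ f) t
  restrictBy-mapTree g f (leaf a)   = refl
  restrictBy-mapTree g f (node l r) = cong₂ _⊕_ (restrictBy-mapTree g f l) (restrictBy-mapTree g f r)

  _≅ᵐ_ : Maybe (Tree A) → Maybe (Tree A) → Set
  _≅ᵐ_ = Pointwise _≅_

  ⊕-≅ : {a a′ b b′ : Maybe (Tree A)} → a ≅ᵐ a′ → b ≅ᵐ b′ → (a ⊕ b) ≅ᵐ (a′ ⊕ b′)
  ⊕-≅ (just p) (just q) = just (node≅ p q)
  ⊕-≅ (just p) nothing  = just p
  ⊕-≅ nothing  q        = q

  ⊕-swap≅ : {a a′ b b′ : Maybe (Tree A)} → a ≅ᵐ b′ → b ≅ᵐ a′ → (a ⊕ b) ≅ᵐ (a′ ⊕ b′)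
  ⊕-swap≅ (just p) (just q) = just (swap≅ p q)
  ⊕-swap≅ (just p) nothing  = just p
  ⊕-swap≅ nothing  (just q) = just q
  ⊕-swap≅ nothing  nothing  = nothing

  restrictBy-≅ : (g : A → Maybe B) {t u : Tree A} → t ≅ u → restrictBy g t ≅ᵐ restrictBy g u
  restrictBy-≅ g (leaf≅ {a}) with g a
  ... | just _  = just leaf≅
  ... | nothing = nothing
  restrictBy-≅ g (node≅ p q) = ⊕-≅ (restrictBy-≅ g p) (restrictBy-≅ g q)
  restrictBy-≅ g (swap≅ p q) = ⊕-swap≅ (restrictBy-≅ g p) (restrictBy-≅ g q)

  leavesᵐ : Maybe (Tree A) → List A
  leavesᵐ = maybe′ leaves []

  leaves-⊕ : (a b : Maybe (Tree A)) → leavesᵐ (a ⊕ b) ≡ leavesᵐ a ++ leavesᵐ b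
  leaves-⊕ (just l) (just r) = refl
  leaves-⊕ (just l) nothing  = sym (ListP.++-identityʳ (leaves l))
  leaves-⊕ nothing  b        = refl

  leaves-restrictBy : (g : A → Maybe B) (t : Tree A) → leavesᵐ (restrictBy g t) ≡ mapMaybe g (leaves t)
  leaves-restrictBy g (leaf a) with g a
  ... | just _  = refl
  ... | nothing = refl
  leaves-restrictBy g (node l r) = begin
    leavesᵐ (restrictBy g l ⊕ restrictBy g r)
      ≡⟨ leaves-⊕ (restrictBy g l) (restrictBy g r) ⟩
    leavesᵐ (restrictBy g l) ++ leavesᵐ (restrictBy g r)
      ≡⟨ cong₂ _++_ (leaves-restrictBy g l) (leaves-restrictBy g r) ⟩
    mapMaybe g (leaves l) ++ mapMaybe g (leaves r)
      ≡⟨ ListP.mapMaybe-++ g (leaves l) (leaves r) ⟨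
    mapMaybe g (leaves l ++ leaves r) ∎
    where open ≡.≡-Reasoning

  sizeᵐ : Maybe (Tree A) → ℕ
  sizeᵐ = maybe′ size 0

  sizeᵐ≡length-leavesᵐ : (a : Maybe (Tree A)) → sizeᵐ a ≡ length (leavesᵐ a)
  sizeᵐ≡length-leavesᵐ (just t) = size≡length-leaves t
  sizeᵐ≡length-leavesᵐ nothing  = refl

  size-restrictBy : (g : A → Maybe B) (t : Tree A) → sizeᵐ (restrictBy g t) ≡ length (mapMaybe g (leaves t))
  size-restrictBy g t = trans (sizeᵐ≡length-leavesᵐ (restrictBy g t)) (cong length (leaves-restrictBy g t))

  size-restrictBy≤ : (g : A → Maybe B) (t : Tree A) → sizeᵐ (restrictBy g t) ≤ size t
  size-restrictBy≤ g t = subst₂ _≤_ (sym (size-restrictBy g t)) (sym (size≡length-leaves t)) (ListP.length-mapMaybe g (leaves t))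

  Kept : (A → Maybe B) → A → Set
  Kept g a = ∃ λ b → g a ≡ just b

  length-mapMaybe-⊆ : (g : A → Maybe B) {ks xs : List A} → ks ⊆ xs → All (Kept g) ks → length ks ≤ length (mapMaybe g xs)
  length-mapMaybe-⊆ g []          _                  = z≤n
  length-mapMaybe-⊆ g (x ∷ʳ ks⊆xs) kept with g x
  ... | just _  = ℕP.m≤n⇒m≤1+n (length-mapMaybe-⊆ g ks⊆xs kept)
  ... | nothing = length-mapMaybe-⊆ g ks⊆xs kept
  length-mapMaybe-⊆ g (refl ∷ ks⊆xs) ((b , gk≡b) ∷ kept) rewrite gk≡b = s≤s (length-mapMaybe-⊆ g ks⊆xs kept)

  size-restrictBy-⊆ : (g : A → Maybe B) (t : Tree A) {ks : List A} → ks ⊆ leaves t → All (Kept g) ks →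
                      length ks ≤ sizeᵐ (restrictBy g t)
  size-restrictBy-⊆ g t ks⊆ kept = subst (_ ≤_) (sym (size-restrictBy g t)) (length-mapMaybe-⊆ g ks⊆ kept)

  -- Wide vertices, caterpillars and Bal4-combs

  -- Leaf counts of the two subtrees at a wide vertex: some five leaves below it restrict to
  -- ((ab)(c(de))), the only five-leaf shape other than Comb₅ and Gir₅.
  Wide : ℕ → ℕ → Set
  Wide p q = 2 ≤ p × 3 ≤ q ⊎ 3 ≤ p × 2 ≤ q

  wide? : ∀ p q → Dec (Wide p q)
  wide? p q = ((2 ≤? p) ×-dec (3 ≤? q)) ⊎-dec ((3 ≤? p) ×-dec (2 ≤? q))

  Wide-mono : ∀ {p q p′ q′} → p ≤ p′ → q ≤ q′ → Wide p q → Wide p′ q′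
  Wide-mono p≤ q≤ (inj₁ (2≤p , 3≤q)) = inj₁ (ℕP.≤-trans 2≤p p≤ , ℕP.≤-trans 3≤q q≤)
  Wide-mono p≤ q≤ (inj₂ (3≤p , 2≤q)) = inj₂ (ℕP.≤-trans 3≤p p≤ , ℕP.≤-trans 2≤q q≤)

  Wide-sym : ∀ {p q} → Wide p q → Wide q p
  Wide-sym (inj₁ (2≤p , 3≤q)) = inj₂ (3≤q , 2≤p)
  Wide-sym (inj₂ (3≤p , 2≤q)) = inj₁ (2≤q , 3≤p)

  ¬Wide-1ˡ : ∀ {q} → ¬ Wide 1 q
  ¬Wide-1ˡ (inj₁ (s≤s () , _))
  ¬Wide-1ˡ (inj₂ (s≤s () , _))

  ¬Wide-1ʳ : ∀ {p} → ¬ Wide p 1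
  ¬Wide-1ʳ = ¬Wide-1ˡ ∘ Wide-sym

  ¬Wide-0ʳ : ∀ {p} → ¬ Wide p 0
  ¬Wide-0ʳ (inj₁ (_ , ()))
  ¬Wide-0ʳ (inj₂ (_ , ()))

  data HasWideSplit {A : Set} : Tree A → Set where
    here  : ∀ {l r} → Wide (size l) (size r) → HasWideSplit (node l r)
    left  : ∀ {l r} → HasWideSplit l → HasWideSplit (node l r)
    right : ∀ {l r} → HasWideSplit r → HasWideSplit (node l r)

  hasWideSplit? : (t : Tree A) → Dec (HasWideSplit t)
  hasWideSplit? (leaf _) = no λ ()
  hasWideSplit? (node l r) with wide? (size l) (size r) | hasWideSplit? l | hasWideSplit? r
  ... | yes w  | _     | _     = yes (here w)
  ... | no _   | yes h | _     = yes (left h)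
  ... | no _   | no _  | yes h = yes (right h)
  ... | no ¬w  | no ¬l | no ¬r = no λ { (here w) → ¬w w ; (left h) → ¬l h ; (right h) → ¬r h }

  HasWideSplit-≅ : {t u : Tree A} → t ≅ u → HasWideSplit t → HasWideSplit u
  HasWideSplit-≅ (node≅ p q) (here w)  = here (subst₂ Wide (size-≅ p) (size-≅ q) w)
  HasWideSplit-≅ (node≅ p q) (left h)  = left (HasWideSplit-≅ p h)
  HasWideSplit-≅ (node≅ p q) (right h) = right (HasWideSplit-≅ q h)
  HasWideSplit-≅ (swap≅ p q) (here w)  = here (Wide-sym (subst₂ Wide (size-≅ p) (size-≅ q) w))
  HasWideSplit-≅ (swap≅ p q) (left h)  = right (HasWideSplit-≅ p h)
  HasWideSplit-≅ (swap≅ p q) (right h) = left (HasWideSplit-≅ q h)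

  data Caterpillar {A : Set} : Tree A → Set where
    leaf  : ∀ {a} → Caterpillar (leaf a)
    leafˡ : ∀ {a r} → Caterpillar r → Caterpillar (node (leaf a) r)
    leafʳ : ∀ {a l} → Caterpillar l → Caterpillar (node l (leaf a))

  NonCaterpillar : Tree A → Set
  NonCaterpillar t = ¬ Caterpillar t

  Caterpillar-≅ : {t u : Tree A} → t ≅ u → Caterpillar t → Caterpillar u
  Caterpillar-≅ leaf≅             leaf      = leaf
  Caterpillar-≅ (node≅ leaf≅ q)   (leafˡ c) = leafˡ (Caterpillar-≅ q c)
  Caterpillar-≅ (node≅ p leaf≅)   (leafʳ c) = leafʳ (Caterpillar-≅ p c)
  Caterpillar-≅ (swap≅ leaf≅ q)   (leafˡ c) = leafʳ (Caterpillar-≅ q c)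
  Caterpillar-≅ (swap≅ p leaf≅)   (leafʳ c) = leafˡ (Caterpillar-≅ p c)

  data Bal4Comb {A : Set} : Tree A → Set where
    bal4  : ∀ {a b c d} → Bal4Comb (node (node (leaf a) (leaf b)) (node (leaf c) (leaf d)))
    leafˡ : ∀ {a r} → Bal4Comb r → Bal4Comb (node (leaf a) r)
    leafʳ : ∀ {a l} → Bal4Comb l → Bal4Comb (node l (leaf a))

  4≤size-Bal4Comb : {t : Tree A} → Bal4Comb t → 4 ≤ size t
  4≤size-Bal4Comb bal4      = ℕP.≤-refl
  4≤size-Bal4Comb (leafˡ b) = ℕP.m≤n⇒m≤1+n (4≤size-Bal4Comb b)
  4≤size-Bal4Comb {t = node l _} (leafʳ b) = ℕP.m≤n⇒m≤n+o 1 (4≤size-Bal4Comb b)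

  Caterpillar⇒¬HasWideSplit : {t : Tree A} → Caterpillar t → ¬ HasWideSplit t
  Caterpillar⇒¬HasWideSplit (leafˡ c) (here w)  = ¬Wide-1ˡ w
  Caterpillar⇒¬HasWideSplit (leafˡ c) (right h) = Caterpillar⇒¬HasWideSplit c h
  Caterpillar⇒¬HasWideSplit (leafʳ c) (here w)  = ¬Wide-1ʳ w
  Caterpillar⇒¬HasWideSplit (leafʳ c) (left h)  = Caterpillar⇒¬HasWideSplit c h

  Bal4Comb⇒¬HasWideSplit : {t : Tree A} → Bal4Comb t → ¬ HasWideSplit t
  Bal4Comb⇒¬HasWideSplit bal4      (here (inj₁ (_ , s≤s (s≤s ()))))
  Bal4Comb⇒¬HasWideSplit bal4      (here (inj₂ (s≤s (s≤s ()) , _)))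
  Bal4Comb⇒¬HasWideSplit bal4      (left h)  = Caterpillar⇒¬HasWideSplit (leafˡ leaf) h
  Bal4Comb⇒¬HasWideSplit bal4      (right h) = Caterpillar⇒¬HasWideSplit (leafˡ leaf) h
  Bal4Comb⇒¬HasWideSplit (leafˡ b) (here w)  = ¬Wide-1ˡ w
  Bal4Comb⇒¬HasWideSplit (leafˡ b) (right h) = Bal4Comb⇒¬HasWideSplit b h
  Bal4Comb⇒¬HasWideSplit (leafʳ b) (here w)  = ¬Wide-1ʳ w
  Bal4Comb⇒¬HasWideSplit (leafʳ b) (left h)  = Bal4Comb⇒¬HasWideSplit b h

  Bal4Comb⇒NonCaterpillar : {t : Tree A} → Bal4Comb t → NonCaterpillar t
  Bal4Comb⇒NonCaterpillar bal4      ()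
  Bal4Comb⇒NonCaterpillar (leafˡ b) (leafˡ c) = Bal4Comb⇒NonCaterpillar b c
  Bal4Comb⇒NonCaterpillar (leafˡ ()) (leafʳ _)
  Bal4Comb⇒NonCaterpillar (leafʳ b) (leafʳ c) = Bal4Comb⇒NonCaterpillar b c
  Bal4Comb⇒NonCaterpillar (leafʳ ()) (leafˡ _)

  2≤size-node : (l r : Tree A) → 2 ≤ size (node l r)
  2≤size-node l r = ℕP.+-mono-≤ (1≤size l) (1≤size r)

  3≤size-nodeˡ : (l r u : Tree A) → 3 ≤ size (node (node l r) u)
  3≤size-nodeˡ l r u = ℕP.+-mono-≤ (2≤size-node l r) (1≤size u)

  3≤size-nodeʳ : (u l r : Tree A) → 3 ≤ size (node u (node l r))
  3≤size-nodeʳ u l r = ℕP.+-mono-≤ (1≤size u) (2≤size-node l r)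

  -- Without a wide split, a vertex with no leaf child has two cherries as children: it is a Bal4.
  ¬HasWideSplit⇒Caterpillar⊎Bal4Comb : (t : Tree A) → ¬ HasWideSplit t → Caterpillar t ⊎ Bal4Comb t
  ¬HasWideSplit⇒Caterpillar⊎Bal4Comb (leaf _) _ = inj₁ leaf
  ¬HasWideSplit⇒Caterpillar⊎Bal4Comb (node (leaf _) r) ¬w
    with ¬HasWideSplit⇒Caterpillar⊎Bal4Comb r (¬w ∘ right)
  ... | inj₁ c = inj₁ (leafˡ c)
  ... | inj₂ b = inj₂ (leafˡ b)
  ¬HasWideSplit⇒Caterpillar⊎Bal4Comb (node l@(node _ _) (leaf _)) ¬w
    with ¬HasWideSplit⇒Caterpillar⊎Bal4Comb l (¬w ∘ left)
  ... | inj₁ c = inj₁ (leafʳ c)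
  ... | inj₂ b = inj₂ (leafʳ b)
  ¬HasWideSplit⇒Caterpillar⊎Bal4Comb (node (node (leaf _) (leaf _)) (node (leaf _) (leaf _))) _ = inj₂ bal4
  ¬HasWideSplit⇒Caterpillar⊎Bal4Comb (node (node (node l₁ l₂) l₃) (node r₁ r₂)) ¬w =
    ⊥-elim (¬w (here (inj₂ (3≤size-nodeˡ l₁ l₂ l₃ , 2≤size-node r₁ r₂))))
  ¬HasWideSplit⇒Caterpillar⊎Bal4Comb (node (node l₀@(leaf _) (node l₁ l₂)) (node r₁ r₂)) ¬w =
    ⊥-elim (¬w (here (inj₂ (3≤size-nodeʳ l₀ l₁ l₂ , 2≤size-node r₁ r₂))))
  ¬HasWideSplit⇒Caterpillar⊎Bal4Comb (node (node (leaf _) (leaf _)) (node (node r₁ r₂) r₃)) ¬w =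
    ⊥-elim (¬w (here (inj₁ (ℕP.≤-refl , 3≤size-nodeˡ r₁ r₂ r₃))))
  ¬HasWideSplit⇒Caterpillar⊎Bal4Comb (node (node (leaf _) (leaf _)) (node r₀@(leaf _) (node r₁ r₂))) ¬w =
    ⊥-elim (¬w (here (inj₁ (ℕP.≤-refl , 3≤size-nodeʳ r₀ r₁ r₂))))

  Caterpillar-restrictBy : (g : A → Maybe B) {t : Tree A} → Caterpillar t → Allᵐ Caterpillar (restrictBy g t)
  Caterpillar-restrictBy g (leaf {a}) with g a
  ... | just _  = just leaf
  ... | nothing = nothing
  Caterpillar-restrictBy g (leafˡ {a} {r} c) with g a | restrictBy g r | Caterpillar-restrictBy g c
  ... | just _  | just _  | just c′ = just (leafˡ c′)
  ... | just _  | nothing | _       = just leaf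
  ... | nothing | _       | c′      = c′
  Caterpillar-restrictBy g (leafʳ {a} {l} c) with restrictBy g l | Caterpillar-restrictBy g c | g a
  ... | just _  | just c′ | just _  = just (leafʳ c′)
  ... | just _  | just c′ | nothing = just c′
  ... | nothing | _       | just _  = just leaf
  ... | nothing | _       | nothing = nothing

  ⊕-HasWideSplit⁻ : {l r : Tree A} (a b : Maybe (Tree B)) → sizeᵐ a ≤ size l → sizeᵐ b ≤ size r →
                    (Anyᵐ HasWideSplit a → HasWideSplit l) → (Anyᵐ HasWideSplit b → HasWideSplit r) →
                    Anyᵐ HasWideSplit (a ⊕ b) → HasWideSplit (node l r)
  ⊕-HasWideSplit⁻ (just _) (just _) sl sr hl hr (just (here w))  = here (Wide-mono sl sr w)
  ⊕-HasWideSplit⁻ (just _) (just _) sl sr hl hr (just (left h))  = left (hl (just h))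
  ⊕-HasWideSplit⁻ (just _) (just _) sl sr hl hr (just (right h)) = right (hr (just h))
  ⊕-HasWideSplit⁻ (just _) nothing  sl sr hl hr h                = left (hl h)
  ⊕-HasWideSplit⁻ nothing  b        sl sr hl hr h                = right (hr h)

  HasWideSplit-restrictBy⁻ : (g : A → Maybe B) (t : Tree A) → Anyᵐ HasWideSplit (restrictBy g t) → HasWideSplit t
  HasWideSplit-restrictBy⁻ g (leaf a) h with g a
  HasWideSplit-restrictBy⁻ g (leaf a) (just ()) | just _
  HasWideSplit-restrictBy⁻ g (leaf a) ()        | nothing
  HasWideSplit-restrictBy⁻ g (node l r) =
    ⊕-HasWideSplit⁻ (restrictBy g l) (restrictBy g r) (size-restrictBy≤ g l) (size-restrictBy≤ g r)
      (HasWideSplit-restrictBy⁻ g l) (HasWideSplit-restrictBy⁻ g r)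

  record FiveLeafWitness {A B : Set} (P : Tree B → Set) (t : Tree A) : Set where
    field
      chosen  : List A
      chosen⊆ : chosen ⊆ leaves t
      #chosen : length chosen ≡ 5
      forces  : (g : A → Maybe B) → All (Kept g) chosen → Anyᵐ P (restrictBy g t)

  module _ {P : Tree B → Set} where

    witness-inˡ : (∀ {a b : Maybe (Tree B)} → Anyᵐ P a → Anyᵐ P (a ⊕ b)) →
                  {l r : Tree A} → FiveLeafWitness P l → FiveLeafWitness P (node l r)
    witness-inˡ P-⊕ {r = r} w = record
      { chosen = chosen ; chosen⊆ = ++⁺ʳ (leaves r) chosen⊆ ; #chosen = #chosen
      ; forces = λ g kept → P-⊕ (forces g kept) }
      where open FiveLeafWitness w

    witness-inʳ : (∀ {a b : Maybe (Tree B)} → Anyᵐ P b → Anyᵐ P (a ⊕ b)) →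
                  {l r : Tree A} → FiveLeafWitness P r → FiveLeafWitness P (node l r)
    witness-inʳ P-⊕ {l = l} w = record
      { chosen = chosen ; chosen⊆ = ++⁺ˡ (leaves l) chosen⊆ ; #chosen = #chosen
      ; forces = λ g kept → P-⊕ (forces g kept) }
      where open FiveLeafWitness w

  HasWideSplit-⊕ˡ : {a b : Maybe (Tree B)} → Anyᵐ HasWideSplit a → Anyᵐ HasWideSplit (a ⊕ b)
  HasWideSplit-⊕ˡ {b = just _}  (just h) = just (left h)
  HasWideSplit-⊕ˡ {b = nothing} (just h) = just h

  HasWideSplit-⊕ʳ : {a b : Maybe (Tree B)} → Anyᵐ HasWideSplit b → Anyᵐ HasWideSplit (a ⊕ b)
  HasWideSplit-⊕ʳ {a = just _}  (just h) = just (right h)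
  HasWideSplit-⊕ʳ {a = nothing} h        = h

  HasWideSplit-⊕ : (a b : Maybe (Tree B)) → Wide (sizeᵐ a) (sizeᵐ b) → Anyᵐ HasWideSplit (a ⊕ b)
  HasWideSplit-⊕ (just _) (just _) w = just (here w)
  HasWideSplit-⊕ (just _) nothing  w = ⊥-elim (¬Wide-0ʳ w)
  HasWideSplit-⊕ nothing  b        (inj₁ (() , _))
  HasWideSplit-⊕ nothing  b        (inj₂ (() , _))

  length-take≤ : ∀ {i} (xs : List A) → i ≤ length xs → length (take i xs) ≡ i
  length-take≤ {i = i} xs i≤ = trans (ListP.length-take i xs) (ℕP.m≤n⇒m⊓n≡m i≤)

  wideRoot-witness : ∀ {i j} (l r : Tree A) → i ≤ size l → j ≤ size r → i + j ≡ 5 → Wide i j →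
                     FiveLeafWitness {B = B} HasWideSplit (node l r)
  wideRoot-witness {i = i} {j} l r i≤ j≤ i+j≡5 w = record
    { chosen  = take i (leaves l) ++ take j (leaves r)
    ; chosen⊆ = ++⁺ (take-Sublist i ⊆-refl) (take-Sublist j ⊆-refl)
    ; #chosen = trans (ListP.length-++ (take i (leaves l))) (trans (cong₂ _+_ #l #r) i+j≡5)
    ; forces  = forces }
    where
    #l : length (take i (leaves l)) ≡ i
    #l = length-take≤ (leaves l) (subst (i ≤_) (size≡length-leaves l) i≤)
    #r : length (take j (leaves r)) ≡ j
    #r = length-take≤ (leaves r) (subst (j ≤_) (size≡length-leaves r) j≤)
    forces : (g : _ → Maybe _) → All (Kept g) (take i (leaves l) ++ take j (leaves r)) → Anyᵐ HasWideSplit (restrictBy g (node l r))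
    forces g kept = HasWideSplit-⊕ (restrictBy g l) (restrictBy g r) (Wide-mono size-l size-r w)
      where
      keptˡ = AllP.++⁻ˡ (take i (leaves l)) kept
      keptʳ = AllP.++⁻ʳ (take i (leaves l)) kept
      size-l = subst (_≤ _) #l (size-restrictBy-⊆ g l (take-Sublist i ⊆-refl) keptˡ)
      size-r = subst (_≤ _) #r (size-restrictBy-⊆ g r (take-Sublist j ⊆-refl) keptʳ)

  HasWideSplit-witness : {t : Tree A} → HasWideSplit t → FiveLeafWitness {B = B} HasWideSplit t
  HasWideSplit-witness {t = node l r} (here (inj₁ (2≤ , 3≤))) = wideRoot-witness l r 2≤ 3≤ refl (inj₁ (ℕP.≤-refl , ℕP.≤-refl))
  HasWideSplit-witness {t = node l r} (here (inj₂ (3≤ , 2≤))) = wideRoot-witness l r 3≤ 2≤ refl (inj₂ (ℕP.≤-refl , ℕP.≤-refl))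
  HasWideSplit-witness (left h)  = witness-inˡ HasWideSplit-⊕ˡ (HasWideSplit-witness h)
  HasWideSplit-witness (right h) = witness-inʳ HasWideSplit-⊕ʳ (HasWideSplit-witness h)

  NonCaterpillar-node : {u v : Tree B} → NonCaterpillar u ⊎ NonCaterpillar v → NonCaterpillar (node u v)
  NonCaterpillar-node (inj₁ ¬c) (leafˡ _) = ¬c leaf
  NonCaterpillar-node (inj₁ ¬c) (leafʳ c) = ¬c c
  NonCaterpillar-node (inj₂ ¬c) (leafˡ c) = ¬c c
  NonCaterpillar-node (inj₂ ¬c) (leafʳ _) = ¬c leaf

  NonCaterpillar-⊕ˡ : {a b : Maybe (Tree B)} → Anyᵐ NonCaterpillar a → Anyᵐ NonCaterpillar (a ⊕ b)
  NonCaterpillar-⊕ˡ {b = just _}  (just ¬c) = just (NonCaterpillar-node (inj₁ ¬c))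
  NonCaterpillar-⊕ˡ {b = nothing} (just ¬c) = just ¬c

  NonCaterpillar-⊕ʳ : {a b : Maybe (Tree B)} → Anyᵐ NonCaterpillar b → Anyᵐ NonCaterpillar (a ⊕ b)
  NonCaterpillar-⊕ʳ {a = just _}  (just ¬c) = just (NonCaterpillar-node (inj₂ ¬c))
  NonCaterpillar-⊕ʳ {a = nothing} h         = h

  NonCaterpillar-restrictBy-bal4 : (g : A → Maybe B) {a b c d : A} → All (Kept g) (a ∷ b ∷ c ∷ d ∷ []) →
    Anyᵐ NonCaterpillar (restrictBy g (node (node (leaf a) (leaf b)) (node (leaf c) (leaf d))))
  NonCaterpillar-restrictBy-bal4 g ((_ , ga) ∷ (_ , gb) ∷ (_ , gc) ∷ (_ , gd) ∷ []) rewrite ga | gb | gc | gd = just λ ()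

  5≤size-leafˡ : {r : Tree A} → Bal4Comb r → 5 ≤ 1 + size r
  5≤size-leafˡ b = s≤s (4≤size-Bal4Comb b)

  5≤size-leafʳ : {l : Tree A} → Bal4Comb l → 5 ≤ size l + 1
  5≤size-leafʳ b = ℕP.+-monoˡ-≤ 1 (4≤size-Bal4Comb b)

  Bal4Comb-witness : {t : Tree A} → Bal4Comb t → 5 ≤ size t → FiveLeafWitness {B = B} NonCaterpillar t
  Bal4Comb-witness bal4 (s≤s (s≤s (s≤s (s≤s ()))))
  Bal4Comb-witness (leafˡ {a = a} bal4) _ = record
    { chosen = _ ; chosen⊆ = ⊆-refl ; #chosen = refl
    ; forces = λ { g (_ ∷ kept) → NonCaterpillar-⊕ʳ {a = restrictBy g (leaf a)} (NonCaterpillar-restrictBy-bal4 g kept) } }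
  Bal4Comb-witness (leafʳ {a = a} bal4) _ = record
    { chosen = _ ; chosen⊆ = ⊆-refl ; #chosen = refl
    ; forces = λ { g (ka ∷ kb ∷ kc ∷ kd ∷ _) →
        NonCaterpillar-⊕ˡ {b = restrictBy g (leaf a)} (NonCaterpillar-restrictBy-bal4 g (ka ∷ kb ∷ kc ∷ kd ∷ [])) } }
  Bal4Comb-witness (leafˡ (leafˡ {a = a} b)) _ = witness-inʳ NonCaterpillar-⊕ʳ (Bal4Comb-witness (leafˡ {a = a} b) (5≤size-leafˡ b))
  Bal4Comb-witness (leafˡ (leafʳ {a = a} b)) _ = witness-inʳ NonCaterpillar-⊕ʳ (Bal4Comb-witness (leafʳ {a = a} b) (5≤size-leafʳ b))
  Bal4Comb-witness (leafʳ (leafˡ {a = a} b)) _ = witness-inˡ NonCaterpillar-⊕ˡ (Bal4Comb-witness (leafˡ {a = a} b) (5≤size-leafˡ b))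
  Bal4Comb-witness (leafʳ (leafʳ {a = a} b)) _ = witness-inˡ NonCaterpillar-⊕ˡ (Bal4Comb-witness (leafʳ {a = a} b) (5≤size-leafʳ b))

  shapeOf : Tree A → Shape
  shapeOf (leaf _)   = lf
  shapeOf (node l r) = nd (shapeOf l) (shapeOf r)

  shapeSize : Shape → ℕ
  shapeSize lf       = 1
  shapeSize (nd s t) = shapeSize s + shapeSize t

  size≡shapeSize : (t : Tree A) → size t ≡ shapeSize (shapeOf t)
  size≡shapeSize (leaf _)   = refl
  size≡shapeSize (node l r) = cong₂ _+_ (size≡shapeSize l) (size≡shapeSize r)

  labelGo-shapeOf : (t : Tree A) (rest : List A) → labelGo (shapeOf t) (leaves t ++ rest) ≡ just (t , rest)
  labelGo-shapeOf (leaf a)   rest = refl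
  labelGo-shapeOf (node l r) rest
    rewrite ListP.++-assoc (leaves l) (leaves r) rest | labelGo-shapeOf l (leaves r ++ rest) | labelGo-shapeOf r rest = refl

  labelGo-leaves : (s : Shape) (as : List A) {t : Tree A} {rest : List A} → labelGo s as ≡ just (t , rest) →
                   leaves t ++ rest ≡ as × shapeOf t ≡ s
  labelGo-leaves lf (a ∷ as) refl = refl , refl
  labelGo-leaves (nd s u) as h with labelGo s as in e₁
  ... | just (l , as′) with labelGo u as′ in e₂
  ...   | just (r , as″) with refl ← h =
    let l-as , shape-l = labelGo-leaves s as e₁
        r-as , shape-r = labelGo-leaves u as′ e₂
    in trans (ListP.++-assoc (leaves l) (leaves r) as″) (trans (cong (leaves l ++_) r-as) l-as) , cong₂ nd shape-l shape-r

  labelGo-map : (f : A → B) (s : Shape) (as : List A) →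
                labelGo s (map f as) ≡ Maybe.map (λ (t , rest) → mapTree f t , map f rest) (labelGo s as)
  labelGo-map f lf []       = refl
  labelGo-map f lf (a ∷ as) = refl
  labelGo-map f (nd s u) as rewrite labelGo-map f s as with labelGo s as
  ... | nothing = refl
  ... | just (l , as′) rewrite labelGo-map f u as′ with labelGo u as′
  ...   | nothing        = refl
  ...   | just (r , as″) = refl

  length-labelGo : (s : Shape) (as : List A) {t : Tree A} {rest : List A} → labelGo s as ≡ just (t , rest) →
                   length as ≡ shapeSize s + length rest
  length-labelGo s as {t} {rest} e = let t-as , shape-t = labelGo-leaves s as e in begin
    length as                       ≡⟨ cong length t-as ⟨
    length (leaves t ++ rest)       ≡⟨ ListP.length-++ (leaves t) ⟩
    length (leaves t) + length rest ≡⟨ cong (_+ length rest) (size≡length-leaves t) ⟨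
    size t + length rest            ≡⟨ cong (_+ length rest) (trans (size≡shapeSize t) (cong shapeSize shape-t)) ⟩
    shapeSize s + length rest       ∎
    where open ≡.≡-Reasoning

  labelGo-defined : (s : Shape) (as : List A) → shapeSize s ≤ length as → ∃₂ λ t rest → labelGo s as ≡ just (t , rest)
  labelGo-defined lf       (a ∷ as) _ = leaf a , as , refl
  labelGo-defined (nd s u) as       s≤
    with l , as′ , e₁ ← labelGo-defined s as (ℕP.≤-trans (ℕP.m≤m+n (shapeSize s) (shapeSize u)) s≤)
    with r , as″ , e₂ ← labelGo-defined u as′ (ℕP.+-cancelˡ-≤ (shapeSize s) _ _ (subst (_ ≤_) (length-labelGo s as e₁) s≤))
    rewrite e₁ | e₂ = node l r , as″ , refl

  labelShape-shapeOf : (t : Tree A) → labelShape (shapeOf t) (leaves t) ≡ just t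
  labelShape-shapeOf t
    with labelGo (shapeOf t) (leaves t) | subst (λ as → labelGo (shapeOf t) as ≡ just (t , [])) (ListP.++-identityʳ (leaves t)) (labelGo-shapeOf t [])
  ... | _ | refl = refl

  labelShape-leaves : (s : Shape) (as : List A) {t : Tree A} → labelShape s as ≡ just t → leaves t ≡ as × shapeOf t ≡ s
  labelShape-leaves s as h with labelGo s as in e
  labelShape-leaves s as refl | just (t , []) =
    let t-as , shape-t = labelGo-leaves s as e in trans (sym (ListP.++-identityʳ (leaves t))) t-as , shape-t

  labelShape-map : (f : A → B) (s : Shape) (as : List A) → labelShape s (map f as) ≡ Maybe.map (mapTree f) (labelShape s as)
  labelShape-map f s as rewrite labelGo-map f s as with labelGo s as
  ... | nothing          = refl
  ... | just (t , [])    = refl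
  ... | just (t , _ ∷ _) = refl

  labelShape-defined : (s : Shape) (as : List A) → length as ≡ shapeSize s → ∃ λ t → labelShape s as ≡ just t
  labelShape-defined s as #as with labelGo-defined s as (ℕP.≤-reflexive (sym #as))
  ... | t , []       , e rewrite e = t , refl
  ... | t , a ∷ rest , e = ⊥-elim (ℕP.m+1+n≢m (shapeSize s) (sym (trans (sym #as) (length-labelGo s as e))))

  comb-suc : (T : Shape) {k : ℕ} → 1 ≤ k → comb T (suc k) ≡ nd lf (comb T k)
  comb-suc T {suc k} _ = refl

  comb-Gir5 : (k : ℕ) → comb Gir5 (suc k) ≡ comb Bal4 (suc (suc k))
  comb-Gir5 zero    = refl
  comb-Gir5 (suc k) = cong (nd lf) (comb-Gir5 k)

  shapeSize-comb : (T : Shape) (k : ℕ) → shapeSize (comb T (suc k)) ≡ shapeSize T + k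
  shapeSize-comb T zero    = sym (ℕP.+-identityʳ (shapeSize T))
  shapeSize-comb T (suc k) = trans (cong suc (shapeSize-comb T k)) (sym (ℕP.+-suc (shapeSize T) k))

  nd-injectiveʳ : ∀ {s t s′ t′} → nd s t ≡ nd s′ t′ → t ≡ t′
  nd-injectiveʳ refl = refl

  Caterpillar-shape : (t : Tree A) (k : ℕ) → shapeOf t ≡ comb lf (suc k) → Caterpillar t
  Caterpillar-shape (leaf _)          _       _ = leaf
  Caterpillar-shape (node (leaf _) r) (suc k) e = leafˡ (Caterpillar-shape r k (nd-injectiveʳ e))

  Bal4Comb-shape : (t : Tree A) (k : ℕ) → shapeOf t ≡ comb Bal4 (suc k) → Bal4Comb t
  Bal4Comb-shape (node (node (leaf _) (leaf _)) (node (leaf _) (leaf _))) zero    refl = bal4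
  Bal4Comb-shape (node (leaf _) r)                                        (suc k) e    = leafˡ (Bal4Comb-shape r k (nd-injectiveʳ e))

  Caterpillar-normalForm : {t : Tree A} → Caterpillar t → ∃ λ t′ → t′ ≅ t × shapeOf t′ ≡ comb lf (size t)
  Caterpillar-normalForm (leaf {a}) = leaf a , leaf≅ , refl
  Caterpillar-normalForm (leafˡ {a} {r} c) with r′ , r′≅r , shape-r′ ← Caterpillar-normalForm c =
    node (leaf a) r′ , node≅ leaf≅ r′≅r , trans (cong (nd lf) shape-r′) (sym (comb-suc lf (1≤size r)))
  Caterpillar-normalForm (leafʳ {a} {l} c) with l′ , l′≅l , shape-l′ ← Caterpillar-normalForm c =
    node (leaf a) l′ , swap≅ leaf≅ l′≅l ,
    trans (cong (nd lf) shape-l′) (trans (sym (comb-suc lf (1≤size l))) (cong (comb lf) (ℕP.+-comm 1 (size l))))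

  comb-Bal4-spine : ∀ k → 4 ≤ k → nd lf (comb Bal4 (k ∸ 3)) ≡ comb Bal4 (1 + k ∸ 3)
  comb-Bal4-spine (suc (suc (suc (suc k)))) _                            = refl
  comb-Bal4-spine (suc (suc (suc zero)))    (s≤s (s≤s (s≤s ())))
  comb-Bal4-spine (suc (suc zero))          (s≤s (s≤s ()))
  comb-Bal4-spine (suc zero)                (s≤s ())

  Bal4Comb-normalForm : {t : Tree A} → Bal4Comb t → ∃ λ t′ → t′ ≅ t × shapeOf t′ ≡ comb Bal4 (size t ∸ 3)
  Bal4Comb-normalForm (bal4 {a} {b} {c} {d}) = node (node (leaf a) (leaf b)) (node (leaf c) (leaf d)) , ≅-refl _ , refl
  Bal4Comb-normalForm (leafˡ {a} {r} b) with r′ , r′≅r , shape-r′ ← Bal4Comb-normalForm b =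
    node (leaf a) r′ , node≅ leaf≅ r′≅r , trans (cong (nd lf) shape-r′) (comb-Bal4-spine (size r) (4≤size-Bal4Comb b))
  Bal4Comb-normalForm (leafʳ {a} {l} b) with l′ , l′≅l , shape-l′ ← Bal4Comb-normalForm b =
    node (leaf a) l′ , swap≅ leaf≅ l′≅l ,
    trans (cong (nd lf) shape-l′) (trans (comb-Bal4-spine (size l) (4≤size-Bal4Comb b)) (cong (λ k → comb Bal4 (k ∸ 3)) (ℕP.+-comm 1 (size l))))

  -- Permutations

  length-allFin : (n : ℕ) → length (allFin n) ≡ n
  length-allFin n = ListP.length-tabulate (λ i → i)

  Unique-resp-↭ : {xs ys : List A} → xs ↭ ys → Unique xs → Unique ys
  Unique-resp-↭ p = ↭ₛP.Unique-resp-↭ (≡.setoid _) (↭⇒↭ₛ p)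

  module _ {n : ℕ} where

    transpose-left : (i j : Fin n) → PermC.transpose i j i ≡ j
    transpose-left i j with i FinP.≟ i
    ... | yes _   = refl
    ... | no i≢i = ⊥-elim (i≢i refl)

    transpose-right : (i j : Fin n) → PermC.transpose i j j ≡ i
    transpose-right i j with j FinP.≟ i
    ... | yes refl = refl
    ... | no _ with j FinP.≟ j
    ...   | yes _   = refl
    ...   | no j≢j = ⊥-elim (j≢j refl)

    transpose-other : (i j k : Fin n) → k ≢ i → k ≢ j → PermC.transpose i j k ≡ k
    transpose-other i j k k≢i k≢j with k FinP.≟ i
    ... | yes k≡i = ⊥-elim (k≢i k≡i)
    ... | no _ with k FinP.≟ j
    ...   | yes k≡j = ⊥-elim (k≢j k≡j)
    ...   | no _    = refl

    -- That τ fixes everything outside xs is what lets the swap case compose with a transposition.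
    ↭⇒Permutation : {xs ys : List (Fin n)} → xs ↭ ys → Unique xs →
                    ∃ λ (τ : Permutation′ n) → map (τ ⟨$⟩ʳ_) xs ≡ ys × (∀ z → z ∉ xs → τ ⟨$⟩ʳ z ≡ z)
    ↭⇒Permutation ↭.refl _ = Perm.id , ListP.map-id _ , λ _ _ → refl
    ↭⇒Permutation (↭.prep x p) (x∉xs ∷ u) with τ , τxs≡ys , τ-fix ← ↭⇒Permutation p u =
      τ , cong₂ _∷_ (τ-fix x (UniqueP.Unique[x∷xs]⇒x∉xs (x∉xs ∷ u))) τxs≡ys , λ z z∉ → τ-fix z (z∉ ∘ there)
    ↭⇒Permutation (↭.swap {xs} {ys} x y p) u@(_ ∷ uy@(_ ∷ uxs))
      with τ , τxs≡ys , τ-fix ← ↭⇒Permutation p uxs = τ ∘ₚ Perm.transpose x y , map≡ , fix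
      where
      x∉xs : x ∉ xs
      x∉xs = UniqueP.Unique[x∷xs]⇒x∉xs u ∘ there
      y∉xs : y ∉ xs
      y∉xs = UniqueP.Unique[x∷xs]⇒x∉xs uy
      t = PermC.transpose x y
      t-fix : ∀ z → z ∈ ys → t z ≡ z
      t-fix z z∈ = transpose-other x y z (λ { refl → x∉xs (↭P.∈-resp-↭ (↭-sym p) z∈) }) (λ { refl → y∉xs (↭P.∈-resp-↭ (↭-sym p) z∈) })
      map≡ : map (t ∘ (τ ⟨$⟩ʳ_)) (x ∷ y ∷ xs) ≡ y ∷ x ∷ ys
      map≡ rewrite τ-fix x x∉xs | τ-fix y y∉xs | transpose-left x y | transpose-right x y =
        cong (λ zs → y ∷ x ∷ zs) (trans (ListP.map-∘ xs) (trans (cong (map t) τxs≡ys) (ListP.map-id-local (All.tabulate λ {z} → t-fix z))))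
      fix : ∀ z → z ∉ x ∷ y ∷ xs → t (τ ⟨$⟩ʳ z) ≡ z
      fix z z∉ rewrite τ-fix z (z∉ ∘ there ∘ there) = transpose-other x y z (z∉ ∘ here) (z∉ ∘ there ∘ here)
    ↭⇒Permutation (↭.trans p q) u
      with τ₁ , τ₁xs≡ys , τ₁-fix ← ↭⇒Permutation p u
      with τ₂ , τ₂ys≡zs , τ₂-fix ← ↭⇒Permutation q (Unique-resp-↭ p u) =
      τ₁ ∘ₚ τ₂ , trans (ListP.map-∘ _) (trans (cong (map (τ₂ ⟨$⟩ʳ_)) τ₁xs≡ys) τ₂ys≡zs) ,
      λ z z∉ → trans (cong (τ₂ ⟨$⟩ʳ_) (τ₁-fix z z∉)) (τ₂-fix z (z∉ ∘ ↭P.∈-resp-↭ (↭-sym p)))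

    allFin-↭⇒Permutation : {xs : List (Fin n)} → xs ↭ allFin n → ∃ λ (τ : Permutation′ n) → map (τ ⟨$⟩ʳ_) (allFin n) ≡ xs
    allFin-↭⇒Permutation xs↭ with τ , τ-allFin , _ ← ↭⇒Permutation (↭-sym xs↭) (UniqueP.allFin⁺ n) = τ , τ-allFin

    map-Permutation-allFin : (σ : Permutation′ n) → map (σ ⟨$⟩ʳ_) (allFin n) ↭ allFin n
    map-Permutation-allFin σ = ∼bag⇒↭ (unique∧set⇒bag
      (UniqueP.map⁺ σ-injective (UniqueP.allFin⁺ n)) (UniqueP.allFin⁺ n)
      (λ {z} → mk⇔ (λ _ → ∈P.∈-allFin z)
                   (λ _ → subst (_∈ map (σ ⟨$⟩ʳ_) (allFin n)) (inverseʳ σ) (∈P.∈-map⁺ (σ ⟨$⟩ʳ_) (∈P.∈-allFin (σ ⟨$⟩ˡ z))))))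
      where
      σ-injective : ∀ {i j} → σ ⟨$⟩ʳ i ≡ σ ⟨$⟩ʳ j → i ≡ j
      σ-injective {i} {j} σi≡σj = trans (sym (inverseˡ σ)) (trans (cong (σ ⟨$⟩ˡ_) σi≡σj) (inverseˡ σ))

    ValidL-shape-relabel : (s : Shape) {C : Tree (Fin n)} → labelShape s (allFin n) ≡ just C →
                           (Q : Tree (Fin n)) → ValidL n Q → shapeOf Q ≡ s → ∃ λ (τ : Permutation′ n) → Q ≡ mapTree (τ ⟨$⟩ʳ_) C
    ValidL-shape-relabel s {C} C≡ Q valid refl with τ , τ-allFin ← allFin-↭⇒Permutation valid = τ , MaybeP.just-injective (begin
      just Q                                             ≡⟨ labelShape-shapeOf Q ⟨
      labelShape (shapeOf Q) (leaves Q)                  ≡⟨ cong (labelShape (shapeOf Q)) τ-allFin ⟨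
      labelShape (shapeOf Q) (map (τ ⟨$⟩ʳ_) (allFin n))   ≡⟨ labelShape-map (τ ⟨$⟩ʳ_) (shapeOf Q) (allFin n) ⟩
      Maybe.map (mapTree (τ ⟨$⟩ʳ_)) (labelShape (shapeOf Q) (allFin n)) ≡⟨ cong (Maybe.map (mapTree (τ ⟨$⟩ʳ_))) C≡ ⟩
      just (mapTree (τ ⟨$⟩ʳ_) C)                         ∎)
      where open ≡.≡-Reasoning

    size-ValidL : (Q : Tree (Fin n)) → ValidL n Q → size Q ≡ n
    size-ValidL Q valid = trans (size≡length-leaves Q) (trans (↭P.↭-length valid) (length-allFin n))

    ValidL-≅ : {Q Q′ : Tree (Fin n)} → Q′ ≅ Q → ValidL n Q → ValidL n Q′
    ValidL-≅ Q′≅Q valid = ↭-trans (≅⇒leaves-↭ Q′≅Q) valid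

    ValidL-labelShape : (s : Shape) {C : Tree (Fin n)} → labelShape s (allFin n) ≡ just C → ValidL n C
    ValidL-labelShape s C≡ = ↭.↭-reflexive (proj₁ (labelShape-leaves s (allFin n) C≡))

  ⊆⇒↭-++ : {ks xs : List A} → ks ⊆ xs → ∃ λ rest → xs ↭ ks ++ rest
  ⊆⇒↭-++ [] = [] , ↭-refl
  ⊆⇒↭-++ {ks = ks} (x ∷ʳ ks⊆) with rest , xs↭ ← ⊆⇒↭-++ ks⊆ = x ∷ rest , ↭-trans (↭.prep x xs↭) (↭-sym (↭P.shift x ks rest))
  ⊆⇒↭-++ (refl ∷ ks⊆) with rest , xs↭ ← ⊆⇒↭-++ ks⊆ = rest , ↭.prep _ xs↭

  record Visible5 {n : ℕ} (P : Tree (Fin 5) → Set) (Q : Tree (Fin n)) : Set where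
    field
      σ          : Permutation′ n
      restricted : Tree (Fin 5)
      restrict≡  : restrict5 (mapTree (σ ⟨$⟩ʳ_) Q) ≡ just restricted
      valid      : ValidL 5 restricted
      holds      : P restricted

  take-++ : (xs ys : List A) → take (length xs) (xs ++ ys) ≡ xs
  take-++ []       ys = refl
  take-++ (x ∷ xs) ys = cong (x ∷_) (take-++ xs ys)

  module _ {m : ℕ} where

    private
      n = 5 + m

    inFin5-tail : ∀ {k} (f : Fin k → Fin n) → (∀ i → 5 ≤ toℕ (f i)) → mapMaybe inFin5 (tabulate f) ≡ []
    inFin5-tail {zero}  f 5≤f = refl
    inFin5-tail {suc k} f 5≤f with toℕ (f Fin.zero) ℕ.<? 5
    ... | yes f0<5 = ⊥-elim (ℕP.<⇒≱ f0<5 (5≤f Fin.zero))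
    ... | no _     = inFin5-tail (f ∘ Fin.suc) (5≤f ∘ Fin.suc)

    mapMaybe-inFin5-allFin : mapMaybe inFin5 (allFin n) ≡ allFin 5
    mapMaybe-inFin5-allFin =
      trans (cong (allFin 5 ++_) (inFin5-tail (Fin.suc ∘ Fin.suc ∘ Fin.suc ∘ Fin.suc ∘ Fin.suc) (λ _ → s≤s (s≤s (s≤s (s≤s (s≤s z≤n)))))))
            (ListP.++-identityʳ (allFin 5))

    Kept-first5 : All (Kept inFin5) (take 5 (allFin n))
    Kept-first5 = (_ , refl) ∷ (_ , refl) ∷ (_ , refl) ∷ (_ , refl) ∷ (_ , refl) ∷ []

    -- Relabel so that the five chosen leaves receive the labels 0, …, 4.
    module _ {P : Tree (Fin 5) → Set} {Q : Tree (Fin n)} (valid : ValidL n Q) (w : FiveLeafWitness P Q) where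
      open FiveLeafWitness w

      private
        complement : ∃ λ rest → leaves Q ↭ chosen ++ rest
        complement = ⊆⇒↭-++ chosen⊆
        rest : List (Fin n)
        rest = proj₁ complement
        relabelling : ∃ λ (τ : Permutation′ n) → map (τ ⟨$⟩ʳ_) (allFin n) ≡ chosen ++ rest
        relabelling = allFin-↭⇒Permutation (↭-trans (↭-sym (proj₂ complement)) valid)
        τ : Permutation′ n
        τ = proj₁ relabelling
        σ : Fin n → Fin n
        σ = Perm.flip τ ⟨$⟩ʳ_
        σ-chosen++rest : map σ (chosen ++ rest) ≡ allFin n
        σ-chosen++rest = trans (cong (map σ) (sym (proj₂ relabelling)))
                               (trans (sym (ListP.map-∘ (allFin n))) (ListP.map-id-local (All.tabulate λ _ → inverseˡ τ)))
        σ-chosen : map σ chosen ≡ take 5 (allFin n)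
        σ-chosen = trans (sym (take-++ (map σ chosen) (map σ rest)))
                         (cong₂ take (trans (ListP.length-map σ chosen) #chosen) (trans (sym (ListP.map-++ σ chosen rest)) σ-chosen++rest))
        kept : All (Kept (inFin5 ∘ σ)) chosen
        kept = AllP.map⁻ (subst (All (Kept inFin5)) (sym σ-chosen) Kept-first5)
        leaves-restrict : mapMaybe (inFin5 ∘ σ) (leaves Q) ↭ allFin 5
        leaves-restrict = ↭-trans (↭P.mapMaybe-↭ (inFin5 ∘ σ) (proj₂ complement)) (↭.↭-reflexive (begin
          mapMaybe (inFin5 ∘ σ) (chosen ++ rest)  ≡⟨ ListP.mapMaybe-map inFin5 σ (chosen ++ rest) ⟨
          mapMaybe inFin5 (map σ (chosen ++ rest)) ≡⟨ cong (mapMaybe inFin5) σ-chosen++rest ⟩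
          mapMaybe inFin5 (allFin n)              ≡⟨ mapMaybe-inFin5-allFin ⟩
          allFin 5                                ∎))
          where open ≡.≡-Reasoning

      visible5 : Visible5 P Q
      visible5 with restrictBy (inFin5 ∘ σ) Q in restrict-eq | forces (inFin5 ∘ σ) kept | leaves-restrictBy (inFin5 ∘ σ) Q
      ... | just S | just PS | leaves-S = record
        { σ = Perm.flip τ ; restricted = S ; holds = PS
        ; restrict≡ = trans (restrict5≡restrictBy (mapTree σ Q)) (trans (restrictBy-mapTree inFin5 σ Q) restrict-eq)
        ; valid = subst (_↭ allFin 5) (sym leaves-S) leaves-restrict }

  concatMap-↭ : (f : A → List B) {xs ys : List A} → xs ↭ ys → concatMap f xs ↭ concatMap f ys
  concatMap-↭ f ↭.refl         = ↭-refl
  concatMap-↭ f (↭.prep x p)   = ↭P.++⁺ˡ (f x) (concatMap-↭ f p)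
  concatMap-↭ f (↭.swap x y p) = ↭-trans (↭P.++⁺ˡ (f x) (↭P.++⁺ˡ (f y) (concatMap-↭ f p))) (↭P.shifts (f x) (f y))
  concatMap-↭ f (↭.trans p q)  = ↭-trans (concatMap-↭ f p) (concatMap-↭ f q)

  concatMap-cong-↭ : {f g : A → List B} → (∀ x → f x ↭ g x) → (xs : List A) → concatMap f xs ↭ concatMap g xs
  concatMap-cong-↭ f↭g []       = ↭-refl
  concatMap-cong-↭ f↭g (x ∷ xs) = ↭P.++⁺ (f↭g x) (concatMap-cong-↭ f↭g xs)

  concatMap-concatMap : (f : B → List C) (g : A → List B) (xs : List A) →
                        concatMap f (concatMap g xs) ≡ concatMap (concatMap f ∘ g) xs
  concatMap-concatMap f g []       = refl
  concatMap-concatMap f g (x ∷ xs) =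
    trans (ListP.concatMap-++ f (g x) (concatMap g xs)) (cong (concatMap f (g x) ++_) (concatMap-concatMap f g xs))

  concatMap-∷-↭ : (u : A → B) (v : A → List B) (xs : List A) →
                  concatMap (λ x → u x ∷ v x) xs ↭ map u xs ++ concatMap v xs
  concatMap-∷-↭ u v []       = ↭-refl
  concatMap-∷-↭ u v (x ∷ xs) =
    ↭.prep (u x) (↭-trans (↭P.++⁺ˡ (v x) (concatMap-∷-↭ u v xs)) (↭P.shifts (v x) (map u xs)))

  insertAll-comm : (x y : A) (l : List A) →
                   concatMap (insertAll x) (insertAll y l) ↭ concatMap (insertAll y) (insertAll x l)
  insertAll-comm x y []       = ↭.swap (x ∷ y ∷ []) (y ∷ x ∷ []) ↭-refl
  insertAll-comm x y (b ∷ bs) = begin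
      concatMap (insertAll x) (insertAll y (b ∷ bs))
    ≡⟨ cong (λ w → (x ∷ y ∷ b ∷ bs) ∷ (y ∷ x ∷ b ∷ bs) ∷ map (y ∷_) (map (b ∷_) (insertAll x bs)) ++ w)
            (ListP.concatMap-map (insertAll x) (b ∷_) (insertAll y bs)) ⟩
      (x ∷ y ∷ b ∷ bs) ∷ (y ∷ x ∷ b ∷ bs) ∷ map (y ∷_) (map (b ∷_) (insertAll x bs)) ++ concatMap (λ l → (x ∷ b ∷ l) ∷ map (b ∷_) (insertAll x l)) (insertAll y bs)
    ≡⟨ cong (λ w → (x ∷ y ∷ b ∷ bs) ∷ (y ∷ x ∷ b ∷ bs) ∷ w ++ concatMap (λ l → (x ∷ b ∷ l) ∷ map (b ∷_) (insertAll x l)) (insertAll y bs))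
            (sym (ListP.map-∘ {g = y ∷_} {f = b ∷_} (insertAll x bs))) ⟩
      (x ∷ y ∷ b ∷ bs) ∷ (y ∷ x ∷ b ∷ bs) ∷ Ax ++ concatMap (λ l → (x ∷ b ∷ l) ∷ map (b ∷_) (insertAll x l)) (insertAll y bs)
    ↭⟨ ↭.swap _ _ (↭P.++⁺ˡ Ax (concatMap-∷-↭ (λ l → x ∷ b ∷ l) (λ l → map (b ∷_) (insertAll x l)) (insertAll y bs))) ⟩
      (y ∷ x ∷ b ∷ bs) ∷ (x ∷ y ∷ b ∷ bs) ∷ Ax ++ Bx ++ concatMap (λ l → map (b ∷_) (insertAll x l)) (insertAll y bs)
    ≡⟨ cong (λ w → (y ∷ x ∷ b ∷ bs) ∷ (x ∷ y ∷ b ∷ bs) ∷ Ax ++ Bx ++ w) (sym (ListP.map-concatMap (b ∷_) (insertAll x) (insertAll y bs))) ⟩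
      (y ∷ x ∷ b ∷ bs) ∷ (x ∷ y ∷ b ∷ bs) ∷ Ax ++ Bx ++ map (b ∷_) (concatMap (insertAll x) (insertAll y bs))
    ↭⟨ ↭.prep _ (↭.prep _ (↭-trans (↭P.shifts Ax Bx) (↭P.++⁺ˡ Bx (↭P.++⁺ˡ Ax (↭P.map⁺ (b ∷_) (insertAll-comm x y bs)))))) ⟩
      (y ∷ x ∷ b ∷ bs) ∷ (x ∷ y ∷ b ∷ bs) ∷ Bx ++ Ax ++ map (b ∷_) (concatMap (insertAll y) (insertAll x bs))
    ≡⟨ cong (λ w → (y ∷ x ∷ b ∷ bs) ∷ (x ∷ y ∷ b ∷ bs) ∷ Bx ++ Ax ++ w) (ListP.map-concatMap (b ∷_) (insertAll y) (insertAll x bs)) ⟩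
      (y ∷ x ∷ b ∷ bs) ∷ (x ∷ y ∷ b ∷ bs) ∷ Bx ++ Ax ++ concatMap (λ l → map (b ∷_) (insertAll y l)) (insertAll x bs)
    ↭⟨ ↭.prep _ (↭.prep _ (↭P.++⁺ (↭.↭-reflexive (ListP.map-∘ {g = x ∷_} {f = b ∷_} (insertAll y bs)))
                                    (↭-sym (concatMap-∷-↭ (λ l → y ∷ b ∷ l) (λ l → map (b ∷_) (insertAll y l)) (insertAll x bs))))) ⟩
      (y ∷ x ∷ b ∷ bs) ∷ (x ∷ y ∷ b ∷ bs) ∷ map (x ∷_) (map (b ∷_) (insertAll y bs)) ++ concatMap (λ l → (y ∷ b ∷ l) ∷ map (b ∷_) (insertAll y l)) (insertAll x bs)
    ≡⟨ cong (λ w → (y ∷ x ∷ b ∷ bs) ∷ (x ∷ y ∷ b ∷ bs) ∷ map (x ∷_) (map (b ∷_) (insertAll y bs)) ++ w)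
            (sym (ListP.concatMap-map (insertAll y) (b ∷_) (insertAll x bs))) ⟩
      concatMap (insertAll y) (insertAll x (b ∷ bs))
    ∎
    where
    open PermutationReasoning
    Ax = map (λ l → y ∷ b ∷ l) (insertAll x bs)
    Bx = map (λ l → x ∷ b ∷ l) (insertAll y bs)

  perms-↭ : {xs ys : List A} → xs ↭ ys → perms xs ↭ perms ys
  perms-↭ ↭.refl        = ↭-refl
  perms-↭ (↭.prep x p)  = concatMap-↭ (insertAll x) (perms-↭ p)
  perms-↭ (↭.swap {xs} {ys} x y p) = begin
      concatMap (insertAll x) (concatMap (insertAll y) (perms xs))
    ↭⟨ concatMap-↭ (insertAll x) (concatMap-↭ (insertAll y) (perms-↭ p)) ⟩
      concatMap (insertAll x) (concatMap (insertAll y) (perms ys))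
    ≡⟨ concatMap-concatMap (insertAll x) (insertAll y) (perms ys) ⟩
      concatMap (λ l → concatMap (insertAll x) (insertAll y l)) (perms ys)
    ↭⟨ concatMap-cong-↭ (insertAll-comm x y) (perms ys) ⟩
      concatMap (λ l → concatMap (insertAll y) (insertAll x l)) (perms ys)
    ≡⟨ concatMap-concatMap (insertAll y) (insertAll x) (perms ys) ⟨
      concatMap (insertAll y) (concatMap (insertAll x) (perms ys))
    ∎
    where open PermutationReasoning
  perms-↭ (↭.trans p q) = ↭-trans (perms-↭ p) (perms-↭ q)

  map-insertAll : (f : A → B) (a : A) (l : List A) → map (map f) (insertAll a l) ≡ insertAll (f a) (map f l)
  map-insertAll f a []       = refl
  map-insertAll f a (b ∷ bs) = cong ((f a ∷ f b ∷ map f bs) ∷_) (begin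
    map (map f) (map (b ∷_) (insertAll a bs))  ≡⟨ ListP.map-∘ (insertAll a bs) ⟨
    map (λ l → f b ∷ map f l) (insertAll a bs) ≡⟨ ListP.map-∘ (insertAll a bs) ⟩
    map (f b ∷_) (map (map f) (insertAll a bs)) ≡⟨ cong (map (f b ∷_)) (map-insertAll f a bs) ⟩
    map (f b ∷_) (insertAll (f a) (map f bs))  ∎)
    where open ≡.≡-Reasoning

  map-perms : (f : A → B) (xs : List A) → map (map f) (perms xs) ≡ perms (map f xs)
  map-perms f []       = refl
  map-perms f (x ∷ xs) = begin
      map (map f) (concatMap (insertAll x) (perms xs))
    ≡⟨ ListP.map-concatMap (map f) (insertAll x) (perms xs) ⟩
      concatMap (λ l → map (map f) (insertAll x l)) (perms xs)
    ≡⟨ ListP.concatMap-cong (map-insertAll f x) (perms xs) ⟩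
      concatMap (λ l → insertAll (f x) (map f l)) (perms xs)
    ≡⟨ ListP.concatMap-map (insertAll (f x)) (map f) (perms xs) ⟨
      concatMap (insertAll (f x)) (map (map f) (perms xs))
    ≡⟨ cong (concatMap (insertAll (f x))) (map-perms f xs) ⟩
      concatMap (insertAll (f x)) (perms (map f xs))
    ∎
    where open ≡.≡-Reasoning

  All-concatMap : {P : A → Set} {Q : B → Set} (f : A → List B) {xs : List A} →
                  (∀ {x} → P x → All Q (f x)) → All P xs → All Q (concatMap f xs)
  All-concatMap f h ps = AllP.concat⁺ (AllP.map⁺ (All.map h ps))

  insertAll-↭ : (a : A) (l : List A) → All (_↭ a ∷ l) (insertAll a l)
  insertAll-↭ a []       = ↭-refl ∷ []
  insertAll-↭ a (b ∷ bs) = ↭-refl ∷ AllP.map⁺ (All.map (λ p → ↭-trans (↭.prep b p) (↭.swap b a ↭-refl)) (insertAll-↭ a bs))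

  perms-↭-self : (xs : List A) → All (_↭ xs) (perms xs)
  perms-↭-self []       = ↭-refl ∷ []
  perms-↭-self (x ∷ xs) =
    All-concatMap (insertAll x) (λ {l} l↭xs → All.map (λ p → ↭-trans p (↭.prep x l↭xs)) (insertAll-↭ x l)) (perms-↭-self xs)

  length-insertAll : (a : A) (l : List A) → length (insertAll a l) ≡ suc (length l)
  length-insertAll a []       = refl
  length-insertAll a (b ∷ bs) = cong suc (trans (ListP.length-map (b ∷_) (insertAll a bs)) (length-insertAll a bs))

  length-concatMap-const : (f : A → List B) (c : ℕ) {xs : List A} → All (λ x → length (f x) ≡ c) xs →
                           length (concatMap f xs) ≡ length xs * c
  length-concatMap-const f c []       = refl
  length-concatMap-const f c {x ∷ xs} (e ∷ es) =
    trans (ListP.length-++ (f x)) (cong₂ _+_ e (length-concatMap-const f c es))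

  length-perms : (xs : List A) → length (perms xs) ≡ length xs !
  length-perms []       = refl
  length-perms (x ∷ xs) = begin
    length (concatMap (insertAll x) (perms xs)) ≡⟨ length-concatMap-const (insertAll x) (suc (length xs))
                                                     (All.map (λ {l} l↭xs → trans (length-insertAll x l) (cong suc (↭P.↭-length l↭xs))) (perms-↭-self xs)) ⟩
    length (perms xs) * suc (length xs)         ≡⟨ cong (_* suc (length xs)) (length-perms xs) ⟩
    length xs ! * suc (length xs)               ≡⟨ ℕP.*-comm (length xs !) (suc (length xs)) ⟩
    suc (length xs) * length xs !               ∎
    where open ≡.≡-Reasoning

  perms-head : (xs : List A) → ∃ λ rest → perms xs ≡ xs ∷ rest
  perms-head []       = [] , refl
  perms-head (x ∷ xs) with rest , e ← perms-head xs rewrite e with xs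
  ... | []     = _ , refl
  ... | _ ∷ _  = _ , refl

open Combinatorics

open import Data.Nat as ℕ using (ℕ; suc; _∸_; _≥_; _!; s≤s)
import Data.Nat.Properties as ℕP
open import Data.Nat.Properties using (_!≢0)
open import Data.Nat.Induction using (<-wellFounded)
open import Induction.WellFounded using (Acc; acc)
import Data.Integer as ℤ
import Data.Integer.Properties as ℤP
import Data.Integer.Solver as ℤSolver
open import Data.Rational as ℚ using (ℚ; 0ℚ; 1ℚ; _+_; _*_; _-_; _/_; _≤_; _<_; 1/_)
import Data.Rational.Properties as ℚP
import Data.Rational.Solver as ℚSolver
import Data.Rational.Unnormalised as ℚᵘ
import Data.Rational.Unnormalised.Properties as ℚᵘP
open import Data.Fin using (Fin)
open import Data.Fin.Permutation as Perm using (Permutation′; _⟨$⟩ʳ_; _⟨$⟩ˡ_; inverseˡ; inverseʳ)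
open import Data.Bool using (Bool; true; false; _∧_; not; if_then_else_)
import Data.Bool.Properties as BoolP
open import Data.List using (List; []; _∷_; _++_; map; mapMaybe; length; allFin; filterᵇ)
import Data.List.Properties as ListP
open import Data.List.Relation.Unary.All as All using (All; []; _∷_)
import Data.List.Relation.Unary.All.Properties as AllP
open import Data.List.Relation.Binary.Permutation.Propositional using (_↭_; ↭⇒↭ₛ)
import Data.List.Relation.Binary.Permutation.Propositional.Properties as ↭P
import Data.List.Relation.Binary.Permutation.Setoid.Properties as ↭ₛP
open import Data.Maybe as Maybe using (Maybe; just; nothing; maybe′)
open import Data.Maybe.Relation.Unary.All using (just; nothing) renaming (All to Allᵐ)
open import Data.Maybe.Relation.Unary.Any using (just)
open import Data.Maybe.Relation.Binary.Pointwise using (just; nothing)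
open import Data.Product using (_×_; _,_; ∃; proj₁; proj₂; map₂)
open import Data.Sum using (_⊎_; inj₁; inj₂)
open import Data.Empty using (⊥-elim)
open import Function using (_∘_; Equivalence)
open import Data.Bool.Properties using (T-≡)
open import Algebra.Bundles using (CommutativeMonoid)
import Algebra.Properties.CommutativeSemigroup as CommutativeSemigroupProperties
open import Level using (0ℓ)
open import Relation.Binary.Bundles using (DecSetoid)
open import Relation.Binary.PropositionalEquality as ≡ using (_≡_; refl; sym; trans; cong; cong₂; subst)
open import Relation.Nullary using (¬_; does; Dec; yes; no; _because_)
open import Relation.Nullary.Reflects using (ofʸ; ofⁿ)

private variable
  A : Set

sumℚ-++ : (xs ys : List ℚ) → sumℚ (xs ++ ys) ≡ sumℚ xs + sumℚ ys
sumℚ-++ []       ys = sym (ℚP.+-identityˡ (sumℚ ys))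
sumℚ-++ (x ∷ xs) ys = trans (cong (x +_) (sumℚ-++ xs ys)) (sym (ℚP.+-assoc x (sumℚ xs) (sumℚ ys)))

sumℚ-↭ : {xs ys : List ℚ} → xs ↭ ys → sumℚ xs ≡ sumℚ ys
sumℚ-↭ p = ↭ₛP.foldr-commMonoid (≡.setoid ℚ) ℚP.+-0-isCommutativeMonoid (↭⇒↭ₛ p)

-- mass D Q and π5 D S are measure (_≅ᵇ Q) D and measure (λ t → restrictIs t S) D, definitionally.
measure : (A → Bool) → List (A × ℚ) → ℚ
measure g D = sumℚ (map (λ e → if g (proj₁ e) then proj₂ e else 0ℚ) D)

NonNegative : List (A × ℚ) → Set
NonNegative D = All (λ e → 0ℚ ≤ proj₂ e) D

scale : ℚ → List (A × ℚ) → List (A × ℚ)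
scale c = map (map₂ (c *_))

measure-cong : {g h : A → Bool} → (∀ x → g x ≡ h x) → (D : List (A × ℚ)) → measure g D ≡ measure h D
measure-cong g≗h D = cong sumℚ (ListP.map-cong (λ e → cong (if_then proj₂ e else 0ℚ) (g≗h (proj₁ e))) D)

measure-++ : (g : A → Bool) (D D′ : List (A × ℚ)) → measure g (D ++ D′) ≡ measure g D + measure g D′
measure-++ g D D′ = trans (cong sumℚ (ListP.map-++ weight D D′)) (sumℚ-++ (map weight D) (map weight D′))
  where weight = λ (e : _ × ℚ) → if g (proj₁ e) then proj₂ e else 0ℚ

measure-scale : (g : A → Bool) (c : ℚ) (D : List (A × ℚ)) → measure g (scale c D) ≡ c * measure g D
measure-scale g c []      = sym (ℚP.*-zeroʳ c)
measure-scale g c (e ∷ D) with g (proj₁ e)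
... | true  = trans (cong (c * proj₂ e +_) (measure-scale g c D)) (sym (ℚP.*-distribˡ-+ c (proj₂ e) (measure g D)))
... | false = trans (cong (0ℚ +_) (measure-scale g c D))
                    (trans (ℚP.+-identityˡ _) (cong (c *_) (sym (ℚP.+-identityˡ (measure g D)))))

measure-none : (g : A → Bool) {D : List (A × ℚ)} → All (λ e → g (proj₁ e) ≡ false) D → measure g D ≡ 0ℚ
measure-none g []                = refl
measure-none g (ge≡false ∷ none) rewrite ge≡false | measure-none g none = ℚP.+-identityˡ 0ℚ

measure-nonneg : (g : A → Bool) {D : List (A × ℚ)} → NonNegative D → 0ℚ ≤ measure g D
measure-nonneg g []                    = ℚP.≤-refl
measure-nonneg g {e ∷ D} (0≤e ∷ 0≤D) with g (proj₁ e)
... | true  = ℚP.+-mono-≤ 0≤e (measure-nonneg g 0≤D)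
... | false = ℚP.+-mono-≤ ℚP.≤-refl (measure-nonneg g 0≤D)

measure-mono : {g h : A → Bool} → (∀ x → g x ≡ true → h x ≡ true) →
               {D : List (A × ℚ)} → NonNegative D → measure g D ≤ measure h D
measure-mono             g⇒h []                    = ℚP.≤-refl
measure-mono {g = g} {h} g⇒h {e ∷ D} (0≤e ∷ 0≤D) with g (proj₁ e) in ge | h (proj₁ e) in he
... | true  | true  = ℚP.+-monoʳ-≤ (proj₂ e) (measure-mono g⇒h 0≤D)
... | true  | false with () ← trans (sym (g⇒h (proj₁ e) ge)) he
... | false | true  = ℚP.+-mono-≤ 0≤e (measure-mono g⇒h 0≤D)
... | false | false = ℚP.+-monoʳ-≤ 0ℚ (measure-mono g⇒h 0≤D)

sumℚ-map-+ : (f h : A → ℚ) (xs : List A) → sumℚ (map (λ x → f x + h x) xs) ≡ sumℚ (map f xs) + sumℚ (map h xs)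
sumℚ-map-+ f h []       = sym (ℚP.+-identityˡ 0ℚ)
sumℚ-map-+ f h (x ∷ xs) = trans (cong (f x + h x +_) (sumℚ-map-+ f h xs)) (interchange (f x) (h x) _ _)
  where open CommutativeSemigroupProperties (CommutativeMonoid.commutativeSemigroup ℚP.+-0-commutativeMonoid) using (interchange)

measure-split : (g k : A → Bool) (D : List (A × ℚ)) →
                measure g D ≡ measure (λ x → g x ∧ k x) D + measure (λ x → g x ∧ not (k x)) D
measure-split g k D = trans (cong sumℚ (ListP.map-cong split D)) (sumℚ-map-+ _ _ D)
  where
  split : ∀ e → (if g (proj₁ e) then proj₂ e else 0ℚ) ≡
                (if g (proj₁ e) ∧ k (proj₁ e) then proj₂ e else 0ℚ) + (if g (proj₁ e) ∧ not (k (proj₁ e)) then proj₂ e else 0ℚ)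
  split e with g (proj₁ e) | k (proj₁ e)
  ... | true  | true  = sym (ℚP.+-identityʳ (proj₂ e))
  ... | true  | false = sym (ℚP.+-identityˡ (proj₂ e))
  ... | false | _     = sym (ℚP.+-identityˡ 0ℚ)

measure-filterᵇ : (g k : A → Bool) (D : List (A × ℚ)) → measure g (filterᵇ (k ∘ proj₁) D) ≡ measure (λ x → g x ∧ k x) D
measure-filterᵇ g k []      = refl
measure-filterᵇ g k (e ∷ D) with k (proj₁ e)
... | true with g (proj₁ e)
...   | true  = cong (proj₂ e +_) (measure-filterᵇ g k D)
...   | false = cong (0ℚ +_) (measure-filterᵇ g k D)
measure-filterᵇ g k (e ∷ D) | false rewrite BoolP.∧-zeroʳ (g (proj₁ e)) =
  trans (measure-filterᵇ g k D) (sym (ℚP.+-identityˡ _))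

measure-false : (D : List (A × ℚ)) → measure (λ _ → false) D ≡ 0ℚ
measure-false D = measure-none (λ _ → false) (All.universal (λ _ → refl) D)

module ClassMeasure (S : DecSetoid 0ℓ 0ℓ) where
  open DecSetoid S using (_≈_; _≟_) renaming (Carrier to X; sym to ≈-sym; trans to ≈-trans)

  classMass : List (X × ℚ) → X → ℚ
  classMass D a = measure (λ x → does (x ≟ a)) D

  removeClass : X → List (X × ℚ) → List (X × ℚ)
  removeClass a = filterᵇ (λ e → not (does (proj₁ e ≟ a)))

  measure-class : (g : X → Bool) → (∀ {x y} → x ≈ y → g x ≡ g y) → (a : X) (D : List (X × ℚ)) →
                  measure (λ x → g x ∧ does (x ≟ a)) D ≡ (if g a then classMass D a else 0ℚ)
  measure-class g g-resp a D = trans (measure-cong pointwise D) (by-value (g a))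
    where
    pointwise : ∀ x → (g x ∧ does (x ≟ a)) ≡ (g a ∧ does (x ≟ a))
    pointwise x with x ≟ a
    ... | yes x≈a = cong (_∧ true) (g-resp x≈a)
    ... | no  _   = trans (BoolP.∧-zeroʳ (g x)) (sym (BoolP.∧-zeroʳ (g a)))
    by-value : ∀ b → measure (λ x → b ∧ does (x ≟ a)) D ≡ (if b then classMass D a else 0ℚ)
    by-value true  = refl
    by-value false = measure-false D

  classMass-removeClass : (a b : X) (D : List (X × ℚ)) →
                          classMass (removeClass a D) b ≡ (if does (b ≟ a) then 0ℚ else classMass D b)
  classMass-removeClass a b D = trans (measure-filterᵇ _ (λ x → not (does (x ≟ a))) D) (case (b ≟ a))
    where
    case : (b≟a : Dec (b ≈ a)) → measure (λ x → does (x ≟ b) ∧ not (does (x ≟ a))) D ≡ (if does b≟a then 0ℚ else classMass D b)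
    case (yes b≈a) = trans (measure-cong pointwise D) (measure-false D)
      where
      pointwise : ∀ x → (does (x ≟ b) ∧ not (does (x ≟ a))) ≡ false
      pointwise x with x ≟ b | x ≟ a
      ... | yes _   | yes _   = refl
      ... | yes x≈b | no  x≉a = ⊥-elim (x≉a (≈-trans x≈b b≈a))
      ... | no  _   | _       = refl
    case (no b≉a) = measure-cong pointwise D
      where
      pointwise : ∀ x → (does (x ≟ b) ∧ not (does (x ≟ a))) ≡ does (x ≟ b)
      pointwise x with x ≟ b | x ≟ a
      ... | yes x≈b | yes x≈a = ⊥-elim (b≉a (≈-trans (≈-sym x≈b) x≈a))
      ... | yes _   | no  _   = refl
      ... | no  _   | _       = refl

  length-removeClass : (a : X) (D : List (X × ℚ)) → length (removeClass a D) ℕ.≤ length D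
  length-removeClass a = ListP.length-filter _

  length-removeClass-head : (e : X × ℚ) (D : List (X × ℚ)) → length (removeClass (proj₁ e) (e ∷ D)) ℕ.≤ length D
  length-removeClass-head e D with proj₁ e ≟ proj₁ e
  ... | yes _   = length-removeClass (proj₁ e) D
  ... | no  e≉e = ⊥-elim (e≉e (DecSetoid.refl S))

  module _ {P : X → Set} (g : X → Bool) (g-resp : ∀ {x y} → x ≈ y → g x ≡ g y) where

    private
      SameClassMasses : List (X × ℚ) → List (X × ℚ) → Set
      SameClassMasses D D′ = ∀ a → P a → classMass D a ≡ classMass D′ a

      measure-via-class : (a : X) (D : List (X × ℚ)) →
                          measure g D ≡ (if g a then classMass D a else 0ℚ) + measure g (removeClass a D)
      measure-via-class a D = begin
        measure g D                                                      ≡⟨ measure-split g (λ x → does (x ≟ a)) D ⟩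
        measure (λ x → g x ∧ does (x ≟ a)) D + measure (λ x → g x ∧ not (does (x ≟ a))) D
          ≡⟨ cong₂ _+_ (measure-class g g-resp a D) (sym (measure-filterᵇ g (λ x → not (does (x ≟ a))) D)) ⟩
        (if g a then classMass D a else 0ℚ) + measure g (removeClass a D) ∎
        where open ≡.≡-Reasoning

      SameClassMasses-removeClass : (a : X) {D D′ : List (X × ℚ)} → SameClassMasses D D′ → SameClassMasses (removeClass a D) (removeClass a D′)
      SameClassMasses-removeClass a {D} {D′} same b Pb =
        trans (classMass-removeClass a b D)
              (trans (cong (if does (b ≟ a) then 0ℚ else_) (same b Pb)) (sym (classMass-removeClass a b D′)))

      All-removeClass : (a : X) {D : List (X × ℚ)} → All (P ∘ proj₁) D → All (P ∘ proj₁) (removeClass a D)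
      All-removeClass a = AllP.filter⁺ _

      agree-via-removeClass : (a : X) {D D′ : List (X × ℚ)} → classMass D a ≡ classMass D′ a →
             measure g (removeClass a D) ≡ measure g (removeClass a D′) → measure g D ≡ measure g D′
      agree-via-removeClass a {D} {D′} same-a same-rest =
        trans (measure-via-class a D)
              (trans (cong₂ _+_ (cong (if g a then_else 0ℚ) same-a) same-rest) (sym (measure-via-class a D′)))

      -- Removing the class of an entry strictly shortens the lists.
      determined : (D D′ : List (X × ℚ)) → Acc ℕ._<_ (length D ℕ.+ length D′) →
           All (P ∘ proj₁) D → All (P ∘ proj₁) D′ → SameClassMasses D D′ → measure g D ≡ measure g D′
      determined []      []       _        _          _           _    = refl
      determined (e ∷ D) D′       (acc rs) (Pe ∷ PD)  PD′         same =
        agree-via-removeClass (proj₁ e) {e ∷ D} {D′} (same _ Pe)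
          (determined (removeClass (proj₁ e) (e ∷ D)) (removeClass (proj₁ e) D′)
              (rs (s≤s (ℕP.+-mono-≤ (length-removeClass-head e D) (length-removeClass (proj₁ e) D′))))
              (All-removeClass (proj₁ e) (Pe ∷ PD)) (All-removeClass (proj₁ e) PD′) (SameClassMasses-removeClass (proj₁ e) {e ∷ D} {D′} same))
      determined []      (e ∷ D′) (acc rs) []         (Pe ∷ PD′)  same =
        agree-via-removeClass (proj₁ e) {[]} {e ∷ D′} (same _ Pe)
          (determined [] (removeClass (proj₁ e) (e ∷ D′)) (rs (s≤s (length-removeClass-head e D′)))
              [] (All-removeClass (proj₁ e) (Pe ∷ PD′)) (SameClassMasses-removeClass (proj₁ e) {[]} {e ∷ D′} same))

    measure-determinedByClasses : (D D′ : List (X × ℚ)) → All (P ∘ proj₁) D → All (P ∘ proj₁) D′ →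
                                  (∀ a → P a → classMass D a ≡ classMass D′ a) → measure g D ≡ measure g D′
    measure-determinedByClasses D D′ = determined D D′ (<-wellFounded _)

-- The distributions p_T

fromℚᵘ-+ : ∀ p q → ℚ.fromℚᵘ (p ℚᵘ.+ q) ≡ ℚ.fromℚᵘ p + ℚ.fromℚᵘ q
fromℚᵘ-+ p q = ℚP.toℚᵘ-injective (ℚᵘP.≃-trans (ℚP.toℚᵘ-fromℚᵘ (p ℚᵘ.+ q))
  (ℚᵘP.≃-sym (ℚᵘP.≃-trans (ℚP.toℚᵘ-homo-+ (ℚ.fromℚᵘ p) (ℚ.fromℚᵘ q)) (ℚᵘP.+-cong (ℚP.toℚᵘ-fromℚᵘ p) (ℚP.toℚᵘ-fromℚᵘ q)))))

-- Added up in ℚᵘ, where fractions over a common denominator are not normalised.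
sumℚ-copies : (d : ℕ) (L : List A) →
              sumℚ (map (λ _ → ℚ.fromℚᵘ (ℚᵘ.mkℚᵘ (ℤ.+ 1) d)) L) ≡ ℚ.fromℚᵘ (ℚᵘ.mkℚᵘ (ℤ.+ length L) d)
sumℚ-copies d []      = sym (ℚP.0/n≡0 (suc d))
sumℚ-copies d (_ ∷ L) = trans (cong (λ s → ℚ.fromℚᵘ (ℚᵘ.mkℚᵘ (ℤ.+ 1) d) + s) (sumℚ-copies d L))
  (trans (sym (fromℚᵘ-+ (ℚᵘ.mkℚᵘ (ℤ.+ 1) d) (ℚᵘ.mkℚᵘ (ℤ.+ length L) d))) (ℚP.fromℚᵘ-cong one-more))
  where
  open ℤ using (+_)
  open ℤSolver.+-*-Solver
  k = length L
  eqn : (+ 1 ℤ.* + suc d ℤ.+ + k ℤ.* + suc d) ℤ.* + suc d ≡ + suc k ℤ.* + (suc d ℕ.* suc d)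
  eqn rewrite ℤP.pos-* (suc d) (suc d) =
    solve 2 (λ K S → (con (+ 1) :* S :+ K :* S) :* S := (con (+ 1) :+ K) :* (S :* S)) refl (+ k) (+ suc d)
  one-more : (ℚᵘ.mkℚᵘ (+ 1) d ℚᵘ.+ ℚᵘ.mkℚᵘ (+ k) d) ℚᵘ.≃ ℚᵘ.mkℚᵘ (+ suc k) d
  one-more = ℚᵘ.*≡* eqn

sumℚ-reciprocals : (m : ℕ) .{{_ : ℕ.NonZero m}} (L : List A) → length L ≡ m → sumℚ (map (λ _ → ℤ.+ 1 / m) L) ≡ 1ℚ
sumℚ-reciprocals (suc d) L #L = trans (sumℚ-copies d L) (trans (cong (λ k → ℚ.fromℚᵘ (ℚᵘ.mkℚᵘ (ℤ.+ k) d)) #L)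
  (ℚP.fromℚᵘ-cong {ℚᵘ.mkℚᵘ (ℤ.+ suc d) d} {ℚᵘ.mkℚᵘ (ℤ.+ 1) 0} (ℚᵘ.*≡* (ℤP.*-comm (ℤ.+ suc d) (ℤ.+ 1)))))

weight : ℕ → ℚ
weight n = (ℤ.+ 1 / n !) {{n !≢0}}

0<weight : (n : ℕ) → 0ℚ < weight n
0<weight n = ℚP.positive⁻¹ (weight n) {{ℚP.normalize-pos 1 (n !) {{n !≢0}}}}

sumℚ-mapMaybe : (h : A × ℚ → ℚ) {B : Set} (F : B → Maybe (A × ℚ)) (L : List B) →
                sumℚ (map h (mapMaybe F L)) ≡ sumℚ (map (maybe′ h 0ℚ ∘ F) L)
sumℚ-mapMaybe h F []      = refl
sumℚ-mapMaybe h F (x ∷ L) with F x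
... | just b  = cong (λ s → h b + s) (sumℚ-mapMaybe h F L)
... | nothing = trans (sumℚ-mapMaybe h F L) (sym (ℚP.+-identityˡ _))

0≤sumℚ : {xs : List ℚ} → All (0ℚ ≤_) xs → 0ℚ ≤ sumℚ xs
0≤sumℚ []           = ℚP.≤-refl
0≤sumℚ (0≤x ∷ 0≤xs) = ℚP.+-mono-≤ 0≤x (0≤sumℚ 0≤xs)

≅ᵇ-relabel : ∀ {n} (σ : Permutation′ n) (t Q : Tree (Fin n)) → (t ≅ᵇ mapTree (σ ⟨$⟩ʳ_) Q) ≡ (mapTree (σ ⟨$⟩ˡ_) t ≅ᵇ Q)
≅ᵇ-relabel σ t Q
  with t ≅ᵇ mapTree (σ ⟨$⟩ʳ_) Q | ≅ᵇ-reflects t (mapTree (σ ⟨$⟩ʳ_) Q) | mapTree (σ ⟨$⟩ˡ_) t ≅ᵇ Q | ≅ᵇ-reflects (mapTree (σ ⟨$⟩ˡ_) t) Q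
... | true  | _      | true  | _      = refl
... | false | _      | false | _      = refl
... | true  | ofʸ p  | false | ofⁿ ¬q = ⊥-elim (¬q (subst (mapTree (σ ⟨$⟩ˡ_) t ≅_) ˡ∘ʳ (mapTree-≅ (σ ⟨$⟩ˡ_) p)))
  where ˡ∘ʳ = trans (mapTree-∘ (σ ⟨$⟩ˡ_) (σ ⟨$⟩ʳ_) Q) (mapTree-id _ (λ _ → inverseˡ σ) Q)
... | false | ofⁿ ¬p | true  | ofʸ q  = ⊥-elim (¬p (subst (_≅ mapTree (σ ⟨$⟩ʳ_) Q) ʳ∘ˡ (mapTree-≅ (σ ⟨$⟩ʳ_) q)))
  where ʳ∘ˡ = trans (mapTree-∘ (σ ⟨$⟩ʳ_) (σ ⟨$⟩ˡ_) t) (mapTree-id _ (λ _ → inverseʳ σ) t)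

module _ (n : ℕ) (T : Shape) where

  weightIf : (Tree (Fin n) → Bool) → List (Fin n) → ℚ
  weightIf g π = maybe′ (λ t → if g t then weight n else 0ℚ) 0ℚ (labelShape T π)

  measure-pShape : (g : Tree (Fin n) → Bool) → measure g (pShape n T) ≡ sumℚ (map (weightIf g) (perms (allFin n)))
  measure-pShape g = trans (sumℚ-mapMaybe _ _ (perms (allFin n))) (cong sumℚ (ListP.map-cong pointwise (perms (allFin n))))
    where
    pointwise : ∀ π → maybe′ (λ e → if g (proj₁ e) then proj₂ e else 0ℚ) 0ℚ (Maybe.map (λ t → t , weight n) (labelShape T π)) ≡ weightIf g π
    pointwise π with labelShape T π
    ... | just _  = refl
    ... | nothing = refl

  All-pShape : {P : Tree (Fin n) × ℚ → Set} → (∀ {π t} → π ↭ allFin n → labelShape T π ≡ just t → P (t , weight n)) →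
               All P (pShape n T)
  All-pShape {P} h = AllP.mapMaybe⁺ (AllP.map⁺ (All.map entry (perms-↭-self (allFin n))))
    where
    entry : ∀ {π} → π ↭ allFin n → Allᵐ P (Maybe.map (λ t → t , weight n) (labelShape T π))
    entry {π} π↭ with labelShape T π in e
    ... | just t  = just (h π↭ e)
    ... | nothing = nothing

  pShape-valid : All (ValidL n ∘ proj₁) (pShape n T)
  pShape-valid = All-pShape λ {π} π↭ e → subst (_↭ allFin n) (sym (proj₁ (labelShape-leaves T π e))) π↭

  pShape-nonNegative : NonNegative (pShape n T)
  pShape-nonNegative = All-pShape λ _ _ → ℚP.<⇒≤ (0<weight n)

  pShape-shapes : All (λ e → shapeOf (proj₁ e) ≡ T) (pShape n T)
  pShape-shapes = All-pShape λ {π} _ e → proj₂ (labelShape-leaves T π e)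

  pShape-total : shapeSize T ≡ n → sumℚ (map proj₂ (pShape n T)) ≡ 1ℚ
  pShape-total T-size = begin
    measure (λ _ → true) (pShape n T)                              ≡⟨ measure-pShape (λ _ → true) ⟩
    sumℚ (map (weightIf (λ _ → true)) (perms (allFin n)))           ≡⟨ cong sumℚ (ListP.map-cong-local (All.map labelled (perms-↭-self (allFin n)))) ⟩
    sumℚ (map (λ _ → weight n) (perms (allFin n)))                  ≡⟨ sumℚ-reciprocals (n !) {{n !≢0}} (perms (allFin n)) #perms ⟩
    1ℚ                                                               ∎
    where
    open ≡.≡-Reasoning
    #perms : length (perms (allFin n)) ≡ n !
    #perms = trans (length-perms (allFin n)) (cong _! (length-allFin n))
    labelled : ∀ {π} → π ↭ allFin n → weightIf (λ _ → true) π ≡ weight n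
    labelled {π} π↭ with t , e ← labelShape-defined T π (trans (↭P.↭-length π↭) (trans (length-allFin n) (sym T-size))) rewrite e = refl

  pShape-exchangeable : Exchangeable n (pShape n T)
  pShape-exchangeable σ Q _ = begin
    measure (_≅ᵇ mapTree (σ ⟨$⟩ʳ_) Q) (pShape n T)          ≡⟨ measure-pShape _ ⟩
    sumℚ (map (weightIf (_≅ᵇ mapTree (σ ⟨$⟩ʳ_) Q)) L)       ≡⟨ cong sumℚ (ListP.map-cong pointwise L) ⟩
    sumℚ (map (weightIf (_≅ᵇ Q) ∘ map (σ ⟨$⟩ˡ_)) L)          ≡⟨ cong sumℚ (ListP.map-∘ L) ⟩
    sumℚ (map (weightIf (_≅ᵇ Q)) (map (map (σ ⟨$⟩ˡ_)) L))    ≡⟨ cong (sumℚ ∘ map (weightIf (_≅ᵇ Q))) (map-perms (σ ⟨$⟩ˡ_) (allFin n)) ⟩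
    sumℚ (map (weightIf (_≅ᵇ Q)) (perms (map (σ ⟨$⟩ˡ_) (allFin n))))
      ≡⟨ sumℚ-↭ (↭P.map⁺ (weightIf (_≅ᵇ Q)) (perms-↭ (map-Permutation-allFin (Perm.flip σ)))) ⟩
    sumℚ (map (weightIf (_≅ᵇ Q)) L)                        ≡⟨ measure-pShape _ ⟨
    measure (_≅ᵇ Q) (pShape n T)                            ∎
    where
    open ≡.≡-Reasoning
    L = perms (allFin n)
    pointwise : ∀ π → weightIf (_≅ᵇ mapTree (σ ⟨$⟩ʳ_) Q) π ≡ weightIf (_≅ᵇ Q) (map (σ ⟨$⟩ˡ_) π)
    pointwise π rewrite labelShape-map (σ ⟨$⟩ˡ_) T π with labelShape T π
    ... | just t  = cong (if_then weight n else 0ℚ) (≅ᵇ-relabel σ t Q)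
    ... | nothing = refl

  0≤weightIf : (g : Tree (Fin n) → Bool) (π : List (Fin n)) → 0ℚ ≤ weightIf g π
  0≤weightIf g π with labelShape T π
  ... | nothing = ℚP.≤-refl
  ... | just t with g t
  ...   | true  = ℚP.<⇒≤ (0<weight n)
  ...   | false = ℚP.≤-refl

  weight≤mass-pShape : {C : Tree (Fin n)} → labelShape T (allFin n) ≡ just C → weight n ≤ mass (pShape n T) C
  weight≤mass-pShape {C} C≡ with rest , perms≡ ← perms-head (allFin n) = begin
    weight n                                                         ≡⟨ ℚP.+-identityʳ (weight n) ⟨
    weight n + 0ℚ                                                    ≤⟨ ℚP.+-monoʳ-≤ (weight n) (0≤sumℚ (AllP.map⁺ (All.universal (0≤weightIf (_≅ᵇ C)) rest))) ⟩
    weight n + sumℚ (map (weightIf (_≅ᵇ C)) rest)                     ≡⟨ cong (λ w → w + sumℚ (map (weightIf (_≅ᵇ C)) rest)) head-weight ⟨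
    weightIf (_≅ᵇ C) (allFin n) + sumℚ (map (weightIf (_≅ᵇ C)) rest)  ≡⟨ cong (sumℚ ∘ map (weightIf (_≅ᵇ C))) perms≡ ⟨
    sumℚ (map (weightIf (_≅ᵇ C)) (perms (allFin n)))                 ≡⟨ measure-pShape (_≅ᵇ C) ⟨
    mass (pShape n T) C                                              ∎
    where
    open ℚP.≤-Reasoning
    head-weight : weightIf (_≅ᵇ C) (allFin n) ≡ weight n
    head-weight rewrite C≡ with C ≅ᵇ C | ≅ᵇ-reflects C C
    ... | true  | _     = refl
    ... | false | ofⁿ ¬p = ⊥-elim (¬p (≅-refl C))

record UniformOnShape (n : ℕ) (T : Shape) (D : WList n) : Set where
  field
    valid         : All (ValidL n ∘ proj₁) D
    nonNegative   : NonNegative D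
    exchangeable  : Exchangeable n D
    shapes        : All (λ e → shapeOf (proj₁ e) ≡ T) D
    total         : shapeSize T ≡ n → sumℚ (map proj₂ D) ≡ 1ℚ
    weight≤mass   : {C : Tree (Fin n)} → labelShape T (allFin n) ≡ just C → weight n ≤ mass D C

pShape-uniform : (n : ℕ) (T : Shape) → UniformOnShape n T (pShape n T)
pShape-uniform n T = record
  { valid = pShape-valid n T ; nonNegative = pShape-nonNegative n T ; exchangeable = pShape-exchangeable n T
  ; shapes = pShape-shapes n T ; total = pShape-total n T ; weight≤mass = weight≤mass-pShape n T }

0≤-+-zero : {p q : ℚ} → 0ℚ ≤ p → 0ℚ ≤ q → p + q ≡ 0ℚ → p ≡ 0ℚ × q ≡ 0ℚ
0≤-+-zero {p} {q} 0≤p 0≤q p+q≡0 =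
  ℚP.≤-antisym (subst (p ≤_) p+q≡0 (subst (_≤ p + q) (ℚP.+-identityʳ p) (ℚP.+-monoʳ-≤ p 0≤q))) 0≤p ,
  ℚP.≤-antisym (subst (q ≤_) p+q≡0 (subst (_≤ p + q) (ℚP.+-identityˡ q) (ℚP.+-monoˡ-≤ q 0≤p))) 0≤q

*-cancel-pos : {c a : ℚ} → 0ℚ < c → c * a ≡ 0ℚ → a ≡ 0ℚ
*-cancel-pos {c} {a} 0<c ca≡0 = begin
  a                 ≡⟨ ℚP.*-identityˡ a ⟨
  1ℚ * a            ≡⟨ cong (_* a) (ℚP.*-inverseˡ c) ⟨
  (1/ c) * c * a    ≡⟨ ℚP.*-assoc (1/ c) c a ⟩
  (1/ c) * (c * a)  ≡⟨ cong ((1/ c) *_) ca≡0 ⟩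
  (1/ c) * 0ℚ       ≡⟨ ℚP.*-zeroʳ (1/ c) ⟩
  0ℚ                ∎
  where
  open ≡.≡-Reasoning
  instance
    c≢0 : ℚ.NonZero c
    c≢0 = ℚP.pos⇒nonZero c {{ℚ.positive 0<c}}

0≤* : {p q : ℚ} → 0ℚ ≤ p → 0ℚ ≤ q → 0ℚ ≤ p * q
0≤* {p} {q} 0≤p 0≤q = ℚP.nonNegative⁻¹ (p * q) {{ℚP.nonNeg*nonNeg⇒nonNeg p {{ℚ.nonNegative 0≤p}} q {{ℚ.nonNegative 0≤q}}}}

0<1- : {λ′ : ℚ} → λ′ < 1ℚ → 0ℚ < 1ℚ - λ′
0<1- {λ′} λ′<1 = subst (_< 1ℚ - λ′) (ℚP.+-inverseʳ λ′) (ℚP.+-monoˡ-< (ℚ.- λ′) λ′<1)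

convex-zero : {λ′ a b : ℚ} → 0ℚ < λ′ → λ′ < 1ℚ → 0ℚ ≤ a → 0ℚ ≤ b →
              λ′ * a + (1ℚ - λ′) * b ≡ 0ℚ → a ≡ 0ℚ × b ≡ 0ℚ
convex-zero 0<λ′ λ′<1 0≤a 0≤b sum≡0
  with λa≡0 , λb≡0 ← 0≤-+-zero (0≤* (ℚP.<⇒≤ 0<λ′) 0≤a) (0≤* (ℚP.<⇒≤ (0<1- λ′<1)) 0≤b) sum≡0 =
  *-cancel-pos 0<λ′ λa≡0 , *-cancel-pos (0<1- λ′<1) λb≡0

convex-extreme : {λ′ a b v : ℚ} → 0ℚ < λ′ → λ′ < 1ℚ → 0ℚ ≤ a → 0ℚ ≤ b → 0ℚ < v →
                 v ≡ λ′ * ((1ℚ - a) * v) + (1ℚ - λ′) * ((1ℚ - b) * v) → a ≡ 0ℚ × b ≡ 0ℚ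
convex-extreme {λ′} {a} {b} {v} 0<λ′ λ′<1 0≤a 0≤b 0<v v≡mix =
  convex-zero 0<λ′ λ′<1 0≤a 0≤b (*-cancel-pos 0<v (begin
    v * (λ′ * a + (1ℚ - λ′) * b)                              ≡⟨ identity λ′ a b v ⟩
    v - (λ′ * ((1ℚ - a) * v) + (1ℚ - λ′) * ((1ℚ - b) * v))    ≡⟨ cong (v -_) v≡mix ⟨
    v - v                                                     ≡⟨ ℚP.+-inverseʳ v ⟩
    0ℚ                                                        ∎))
  where
  open ≡.≡-Reasoning
  open ℚSolver.+-*-Solver
  identity : ∀ λ′ a b v → v * (λ′ * a + (1ℚ - λ′) * b) ≡ v - (λ′ * ((1ℚ - a) * v) + (1ℚ - λ′) * ((1ℚ - b) * v))
  identity = solve 4 (λ l a b v → v :* (l :* a :+ (con 1ℚ :- l) :* b) :=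
                                   v :- (l :* ((con 1ℚ :- a) :* v) :+ (con 1ℚ :- l) :* ((con 1ℚ :- b) :* v))) refl

module _ (x c : ℚ) (0<c : 0ℚ < c) where

  private instance
    c≢0 : ℚ.NonZero c
    c≢0 = ℚP.pos⇒nonZero c {{ℚ.positive 0<c}}

  divide : ℚ
  divide = x * 1/ c

  divide-* : divide * c ≡ x
  divide-* = trans (ℚP.*-assoc x (1/ c) c) (trans (cong (x *_) (ℚP.*-inverseˡ c)) (ℚP.*-identityʳ x))

  0≤divide : 0ℚ ≤ x → 0ℚ ≤ divide
  0≤divide 0≤x = 0≤* 0≤x (ℚP.<⇒≤ (ℚP.positive⁻¹ (1/ c) {{ℚP.1/pos⇒pos c {{ℚ.positive 0<c}}}}))

+≡1⇒≡1- : {a b : ℚ} → a + b ≡ 1ℚ → b ≡ 1ℚ - a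
+≡1⇒≡1- {a} {b} a+b≡1 = trans (identity a b) (cong (_- a) a+b≡1)
  where
  open ℚSolver.+-*-Solver
  identity : ∀ a b → b ≡ (a + b) - a
  identity = solve 2 (λ a b → b := (a :+ b) :- a) refl

-- The vertex

≅-decSetoid : ℕ → DecSetoid 0ℓ 0ℓ
≅-decSetoid k = record
  { Carrier = Tree (Fin k) ; _≈_ = _≅_
  ; isDecEquivalence = record
    { isEquivalence = record { refl = ≅-refl _ ; sym = ≅-sym ; trans = ≅-trans }
    ; _≟_ = λ t u → (t ≅ᵇ u) because ≅ᵇ-reflects t u } }

module _ {n : ℕ} where

  mass-≅ : (D : WList n) {Q Q′ : Tree (Fin n)} → Q ≅ Q′ → mass D Q ≡ mass D Q′
  mass-≅ D Q≅Q′ = measure-cong (λ t → ≅ᵇ-cong (≅-refl t) Q≅Q′) D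

  mass-none : {P : Tree (Fin n) → Set} {D : WList n} {Q : Tree (Fin n)} → All (P ∘ proj₁) D →
              (∀ {t} → P t → ¬ t ≅ Q) → mass D Q ≡ 0ℚ
  mass-none {P} {D} {Q} entries P⇒≇ = measure-none (_≅ᵇ Q) {D} (All.map (λ {e} → never {e}) entries)
    where
    never : ∀ {e : Tree (Fin n) × ℚ} → P (proj₁ e) → (proj₁ e ≅ᵇ Q) ≡ false
    never {e} Pe with proj₁ e ≅ᵇ Q | ≅ᵇ-reflects (proj₁ e) Q
    ... | true  | ofʸ e≅Q = ⊥-elim (P⇒≇ Pe e≅Q)
    ... | false | _       = refl

  mass-shapeClass : {D : WList n} → Exchangeable n D → (s : Shape) {C : Tree (Fin n)} → labelShape s (allFin n) ≡ just C →
                    {Q : Tree (Fin n)} → ValidL n Q → (∃ λ Q′ → Q′ ≅ Q × shapeOf Q′ ≡ s) → mass D Q ≡ mass D C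
  mass-shapeClass {D} exchangeable s C≡ valid (Q′ , Q′≅Q , shape-Q′)
    with τ , Q′≡τC ← ValidL-shape-relabel s C≡ Q′ (ValidL-≅ Q′≅Q valid) shape-Q′ =
    trans (mass-≅ D (≅-sym Q′≅Q)) (trans (cong (mass D) Q′≡τC) (exchangeable τ _ (ValidL-labelShape s C≡)))

  restrictIs≡ : (t : Tree (Fin n)) (S : Tree (Fin 5)) → restrictIs t S ≡ maybe′ (_≅ᵇ S) false (restrict5 t)
  restrictIs≡ t S with restrict5 t
  ... | just _  = refl
  ... | nothing = refl

  restrictIs-≅ : (S : Tree (Fin 5)) {t u : Tree (Fin n)} → t ≅ u → restrictIs t S ≡ restrictIs u S
  restrictIs-≅ S {t} {u} t≅u
    rewrite restrictIs≡ t S | restrictIs≡ u S | restrict5≡restrictBy t | restrict5≡restrictBy u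
    with restrictBy inFin5 t | restrictBy inFin5 u | restrictBy-≅ inFin5 t≅u
  ... | just _  | just _  | just p  = ≅ᵇ-cong p (≅-refl S)
  ... | nothing | nothing | nothing = refl

  restrictIs-restrict5 : (t : Tree (Fin n)) {S : Tree (Fin 5)} → restrict5 t ≡ just S → restrictIs t S ≡ true
  restrictIs-restrict5 t {S} restrict≡ rewrite restrictIs≡ t S | restrict≡ with S ≅ᵇ S | ≅ᵇ-reflects S S
  ... | true  | _      = refl
  ... | false | ofⁿ ¬p = ⊥-elim (¬p (≅-refl S))

  restrictIs-false : {P : Tree (Fin 5) → Set} → (∀ {u v} → u ≅ v → P u → P v) →
                     (t : Tree (Fin n)) → Allᵐ P (restrict5 t) → {S : Tree (Fin 5)} → ¬ P S → restrictIs t S ≡ false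
  restrictIs-false P-≅ t P-restrict {S} ¬PS rewrite restrictIs≡ t S with restrict5 t | P-restrict
  ... | nothing | _       = refl
  ... | just u  | just Pu with u ≅ᵇ S | ≅ᵇ-reflects u S
  ...   | true  | ofʸ u≅S = ⊥-elim (¬PS (P-≅ u≅S Pu))
  ...   | false | _       = refl

  Caterpillar-restrict5 : {t : Tree (Fin n)} → Caterpillar t → Allᵐ Caterpillar (restrict5 t)
  Caterpillar-restrict5 {t} c rewrite restrict5≡restrictBy t = Caterpillar-restrictBy inFin5 c

  ¬HasWideSplit-restrict5 : {t : Tree (Fin n)} → ¬ HasWideSplit t → Allᵐ (¬_ ∘ HasWideSplit) (restrict5 t)
  ¬HasWideSplit-restrict5 {t} ¬w rewrite restrict5≡restrictBy t
    with restrictBy inFin5 t | HasWideSplit-restrictBy⁻ inFin5 t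
  ... | just _  | lift = just λ w → ¬w (lift (just w))
  ... | nothing | _    = nothing

  π5-none : {P : Tree (Fin 5) → Set} → (∀ {u v} → u ≅ v → P u → P v) →
            {D : WList n} → All (λ e → Allᵐ P (restrict5 (proj₁ e))) D → {S : Tree (Fin 5)} → ¬ P S → π5 D S ≡ 0ℚ
  π5-none P-≅ entries ¬PS = measure-none _ (All.map (λ {e} P-restrict → restrictIs-false P-≅ (proj₁ e) P-restrict ¬PS) entries)

  mass≤π5 : {D : WList n} → NonNegative D → Exchangeable n D → {Q : Tree (Fin n)} → ValidL n Q →
            {P : Tree (Fin 5) → Set} (v : Visible5 P Q) → mass D Q ≤ π5 D (Visible5.restricted v)
  mass≤π5 {D} nonNeg exchangeable {Q} Q-valid v = subst (_≤ _) (exchangeable σ Q Q-valid) (measure-mono class⇒restricted nonNeg)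
    where
    open Visible5 v using (σ; restricted; restrict≡)
    class⇒restricted : ∀ t → (t ≅ᵇ mapTree (σ ⟨$⟩ʳ_) Q) ≡ true → restrictIs t restricted ≡ true
    class⇒restricted t t≅σQ = trans (restrictIs-≅ restricted (≅ᵇ-sound t _ (Equivalence.from T-≡ t≅σQ)))
                                    (restrictIs-restrict5 (mapTree (σ ⟨$⟩ʳ_) Q) restrict≡)

module Vertex (m : ℕ) where

  n : ℕ
  n = 5 ℕ.+ m

  -- Opaque: unfolding pShape would let the typechecker expand perms (allFin n).
  opaque
    pComb pT : WList n
    pComb = pShape n (comb lf n)
    pT    = pShape n (Tn n)

    pT≡ : pT ≡ pShape n (Tn n)
    pT≡ = refl

    pComb-uniform : UniformOnShape n (comb lf n) pComb
    pComb-uniform = pShape-uniform n (comb lf n)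

    pT-uniform : UniformOnShape n (Tn n) pT
    pT-uniform = pShape-uniform n (Tn n)

  module pComb = UniformOnShape pComb-uniform
  module pT    = UniformOnShape pT-uniform

  Tn≡comb-Bal4 : Tn n ≡ comb Bal4 (n ∸ 3)
  Tn≡comb-Bal4 = comb-Gir5 m

  opaque
    canonical : (s : Shape) → shapeSize s ≡ n → ∃ λ C → labelShape s (allFin n) ≡ just C
    canonical s s-size = labelShape-defined s (allFin n) (trans (length-allFin n) (sym s-size))

  Ccomb CT : Tree (Fin n)
  Ccomb = proj₁ (canonical (comb lf n) (shapeSize-comb lf (4 ℕ.+ m)))
  CT    = proj₁ (canonical (Tn n) (shapeSize-comb Gir5 m))

  Ccomb≡ : labelShape (comb lf n) (allFin n) ≡ just Ccomb
  Ccomb≡ = proj₂ (canonical (comb lf n) (shapeSize-comb lf (4 ℕ.+ m)))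

  CT≡ : labelShape (Tn n) (allFin n) ≡ just CT
  CT≡ = proj₂ (canonical (Tn n) (shapeSize-comb Gir5 m))

  Caterpillar-pComb : All (Caterpillar ∘ proj₁) pComb
  Caterpillar-pComb = All.map (λ {e} shape≡ → Caterpillar-shape (proj₁ e) (4 ℕ.+ m) shape≡) pComb.shapes

  Bal4Comb-pT : All (Bal4Comb ∘ proj₁) pT
  Bal4Comb-pT = All.map (λ {e} shape≡ → Bal4Comb-shape (proj₁ e) (suc m) (trans shape≡ Tn≡comb-Bal4)) pT.shapes

  Bal4Comb-CT : Bal4Comb CT
  Bal4Comb-CT = Bal4Comb-shape CT (suc m) (trans (proj₂ (labelShape-leaves (Tn n) (allFin n) CT≡)) Tn≡comb-Bal4)

  mass-Caterpillar : {D : WList n} → Exchangeable n D → {Q : Tree (Fin n)} → ValidL n Q → Caterpillar Q → mass D Q ≡ mass D Ccomb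
  mass-Caterpillar {D} exchangeable {Q} valid c with Q′ , Q′≅Q , shape-Q′ ← Caterpillar-normalForm c =
    mass-shapeClass {D = D} exchangeable (comb lf n) Ccomb≡ {Q = Q} valid (Q′ , Q′≅Q , trans shape-Q′ (cong (comb lf) (size-ValidL Q valid)))

  mass-Bal4Comb : {D : WList n} → Exchangeable n D → {Q : Tree (Fin n)} → ValidL n Q → Bal4Comb Q → mass D Q ≡ mass D CT
  mass-Bal4Comb {D} exchangeable {Q} valid b with Q′ , Q′≅Q , shape-Q′ ← Bal4Comb-normalForm b =
    mass-shapeClass {D = D} exchangeable (Tn n) CT≡ {Q = Q} valid
      (Q′ , Q′≅Q , trans shape-Q′ (trans (cong (λ k → comb Bal4 (k ∸ 3)) (size-ValidL Q valid)) (sym Tn≡comb-Bal4)))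

  mass-pComb-nonCaterpillar : {Q : Tree (Fin n)} → NonCaterpillar Q → mass pComb Q ≡ 0ℚ
  mass-pComb-nonCaterpillar ¬c = mass-none Caterpillar-pComb λ c t≅Q → ¬c (Caterpillar-≅ t≅Q c)

  mass-pT-Caterpillar : {Q : Tree (Fin n)} → Caterpillar Q → mass pT Q ≡ 0ℚ
  mass-pT-Caterpillar c = mass-none Bal4Comb-pT λ b t≅Q → Bal4Comb⇒NonCaterpillar b (Caterpillar-≅ (≅-sym t≅Q) c)

  mass-pT-HasWideSplit : {Q : Tree (Fin n)} → HasWideSplit Q → mass pT Q ≡ 0ℚ
  mass-pT-HasWideSplit w = mass-none Bal4Comb-pT λ b t≅Q → Bal4Comb⇒¬HasWideSplit b (HasWideSplit-≅ (≅-sym t≅Q) w)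

  π5-pComb-nonCaterpillar : {S : Tree (Fin 5)} → NonCaterpillar S → π5 pComb S ≡ 0ℚ
  π5-pComb-nonCaterpillar = π5-none Caterpillar-≅ (All.map (λ {e} → Caterpillar-restrict5 {t = proj₁ e}) Caterpillar-pComb)

  π5-pT-HasWideSplit : {S : Tree (Fin 5)} → HasWideSplit S → π5 pT S ≡ 0ℚ
  π5-pT-HasWideSplit w = π5-none (λ u≅v ¬wu → ¬wu ∘ HasWideSplit-≅ (≅-sym u≅v))
    (All.map (λ {e} b → ¬HasWideSplit-restrict5 {t = proj₁ e} (Bal4Comb⇒¬HasWideSplit b)) Bal4Comb-pT) (λ ¬w → ¬w w)

  cComb cT : ℚ
  cComb = mass pComb Ccomb
  cT    = mass pT CT

  0<cComb : 0ℚ < cComb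
  0<cComb = ℚP.<-≤-trans (0<weight n) (pComb.weight≤mass Ccomb≡)

  0<cT : 0ℚ < cT
  0<cT = ℚP.<-≤-trans (0<weight n) (pT.weight≤mass CT≡)

  record Decomposition (D : WList n) : Set where
    field
      α β   : ℚ
      0≤α   : 0ℚ ≤ α
      α+β≡1 : α + β ≡ 1ℚ
      π5≡   : ∀ S → π5 D S ≡ α * π5 pComb S + β * π5 pT S

  record Admissible (D : WList n) : Set where
    field
      valid        : All (ValidL n ∘ proj₁) D
      nonNegative  : NonNegative D
      exchangeable : Exchangeable n D
      wideNull     : ∀ S → ValidL 5 S → HasWideSplit S → π5 D S ≡ 0ℚ

  module _ {D : WList n} (adm : Admissible D) where
    open Admissible adm

    mass-HasWideSplit : {Q : Tree (Fin n)} → ValidL n Q → HasWideSplit Q → mass D Q ≡ 0ℚ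
    mass-HasWideSplit Q-valid w = ℚP.≤-antisym
      (ℚP.≤-trans (mass≤π5 nonNegative exchangeable Q-valid v) (ℚP.≤-reflexive (wideNull restricted R-valid holds)))
      (measure-nonneg _ nonNegative)
      where
      v = visible5 Q-valid (HasWideSplit-witness w)
      open Visible5 v renaming (valid to R-valid)

    private
      α β : ℚ
      α = divide (mass D Ccomb) cComb 0<cComb
      β = divide (mass D CT) cT 0<cT

      mixture : WList n
      mixture = scale α pComb ++ scale β pT

      combine : ℚ → ℚ → ℚ
      combine u v = α * u + β * v

      measure-mixture : (g : Tree (Fin n) → Bool) → measure g mixture ≡ α * measure g pComb + β * measure g pT
      measure-mixture g = trans (measure-++ g (scale α pComb) (scale β pT)) (cong₂ _+_ (measure-scale g α pComb) (measure-scale g β pT))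

      mass-decomposition : ∀ Q → ValidL n Q → mass D Q ≡ mass mixture Q
      mass-decomposition Q Q-valid = trans (by-class (hasWideSplit? Q)) (sym (measure-mixture (_≅ᵇ Q)))
        where
        open ≡.≡-Reasoning
        by-class : Dec (HasWideSplit Q) → mass D Q ≡ α * mass pComb Q + β * mass pT Q
        by-class (yes w) = begin
          mass D Q
            ≡⟨ mass-HasWideSplit Q-valid w ⟩
          0ℚ
            ≡⟨ trans (cong₂ _+_ (ℚP.*-zeroʳ α) (ℚP.*-zeroʳ β)) (ℚP.+-identityˡ 0ℚ) ⟨
          α * 0ℚ + β * 0ℚ
            ≡⟨ cong₂ combine (mass-pComb-nonCaterpillar (λ c → Caterpillar⇒¬HasWideSplit c w)) (mass-pT-HasWideSplit w) ⟨
          α * mass pComb Q + β * mass pT Q ∎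
        by-class (no ¬w) = by-shape (¬HasWideSplit⇒Caterpillar⊎Bal4Comb Q ¬w)
          where
          by-shape : Caterpillar Q ⊎ Bal4Comb Q → mass D Q ≡ α * mass pComb Q + β * mass pT Q
          by-shape (inj₁ c) = begin
            mass D Q
              ≡⟨ mass-Caterpillar {D} exchangeable Q-valid c ⟩
            mass D Ccomb
              ≡⟨ divide-* (mass D Ccomb) cComb 0<cComb ⟨
            α * cComb
              ≡⟨ trans (cong (α * cComb +_) (ℚP.*-zeroʳ β)) (ℚP.+-identityʳ (α * cComb)) ⟨
            α * cComb + β * 0ℚ
              ≡⟨ cong₂ combine (mass-Caterpillar {pComb} pComb.exchangeable Q-valid c) (mass-pT-Caterpillar c) ⟨
            α * mass pComb Q + β * mass pT Q ∎
          by-shape (inj₂ b) = begin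
            mass D Q
              ≡⟨ mass-Bal4Comb {D} exchangeable Q-valid b ⟩
            mass D CT
              ≡⟨ divide-* (mass D CT) cT 0<cT ⟨
            β * cT
              ≡⟨ trans (cong (_+ β * cT) (ℚP.*-zeroʳ α)) (ℚP.+-identityˡ (β * cT)) ⟨
            α * 0ℚ + β * cT
              ≡⟨ cong₂ combine (mass-pComb-nonCaterpillar (Bal4Comb⇒NonCaterpillar b)) (mass-Bal4Comb {pT} pT.exchangeable Q-valid b) ⟨
            α * mass pComb Q + β * mass pT Q ∎

      measure-decomposition : (g : Tree (Fin n) → Bool) → (∀ {t u} → t ≅ u → g t ≡ g u) →
                              measure g D ≡ α * measure g pComb + β * measure g pT
      measure-decomposition g g-≅ = trans
        (ClassMeasure.measure-determinedByClasses (≅-decSetoid n) g g-≅ D mixture valid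
          (AllP.++⁺ (AllP.map⁺ pComb.valid) (AllP.map⁺ pT.valid)) mass-decomposition)
        (measure-mixture g)

    decompose : sumℚ (map proj₂ D) ≡ 1ℚ → Decomposition D
    decompose total = record
      { α = α ; β = β ; 0≤α = 0≤divide (mass D Ccomb) cComb 0<cComb (measure-nonneg _ nonNegative)
      ; α+β≡1 = begin
          α + β
            ≡⟨ cong₂ _+_ (ℚP.*-identityʳ α) (ℚP.*-identityʳ β) ⟨
          α * 1ℚ + β * 1ℚ
            ≡⟨ cong₂ combine (pComb.total (shapeSize-comb lf (4 ℕ.+ m))) (pT.total (shapeSize-comb Gir5 m)) ⟨
          α * measure (λ _ → true) pComb + β * measure (λ _ → true) pT
            ≡⟨ measure-decomposition (λ _ → true) (λ _ → refl) ⟨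
          measure (λ _ → true) D
            ≡⟨ total ⟩
          1ℚ ∎
      ; π5≡ = λ S → measure-decomposition (λ t → restrictIs t S) (restrictIs-≅ S) }
      where open ≡.≡-Reasoning

  -- A five-leaf restriction of CT containing its Bal4: p_Comb never produces it, p_T does.
  G-visible : Visible5 NonCaterpillar CT
  G-visible = visible5 CT-valid (Bal4Comb-witness Bal4Comb-CT (subst (5 ℕ.≤_) (sym (size-ValidL CT CT-valid)) (ℕP.m≤m+n 5 m)))
    where CT-valid = ValidL-labelShape (Tn n) CT≡

  G : Tree (Fin 5)
  G = Visible5.restricted G-visible

  G-valid : ValidL 5 G
  G-valid = Visible5.valid G-visible

  π5-pComb-G : π5 pComb G ≡ 0ℚ
  π5-pComb-G = π5-pComb-nonCaterpillar (Visible5.holds G-visible)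

  0<π5-pT-G : 0ℚ < π5 pT G
  0<π5-pT-G = ℚP.<-≤-trans 0<cT (mass≤π5 pT.nonNegative pT.exchangeable (ValidL-labelShape (Tn n) CT≡) G-visible)

  module _ {D : WList n} (dec : Decomposition D) where
    open Decomposition dec

    π5-G : π5 D G ≡ (1ℚ - α) * π5 pT G
    π5-G = begin
      π5 D G                          ≡⟨ π5≡ G ⟩
      α * π5 pComb G + β * π5 pT G    ≡⟨ cong₂ (λ u b → α * u + b * π5 pT G) π5-pComb-G (+≡1⇒≡1- {α} {β} α+β≡1) ⟩
      α * 0ℚ + (1ℚ - α) * π5 pT G     ≡⟨ cong (_+ (1ℚ - α) * π5 pT G) (ℚP.*-zeroʳ α) ⟩
      0ℚ + (1ℚ - α) * π5 pT G         ≡⟨ ℚP.+-identityˡ _ ⟩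
      (1ℚ - α) * π5 pT G              ∎
      where open ≡.≡-Reasoning

    π5≡π5-pT : α ≡ 0ℚ → ∀ S → π5 D S ≡ π5 pT S
    π5≡π5-pT α≡0 S = begin
      π5 D S
        ≡⟨ π5≡ S ⟩
      α * π5 pComb S + β * π5 pT S
        ≡⟨ cong₂ (λ a b → a * π5 pComb S + b * π5 pT S) α≡0 (trans (+≡1⇒≡1- {α} {β} α+β≡1) (cong (1ℚ -_) α≡0)) ⟩
      0ℚ * π5 pComb S + (1ℚ - 0ℚ) * π5 pT S
        ≡⟨ cong (_+ (1ℚ - 0ℚ) * π5 pT S) (ℚP.*-zeroˡ (π5 pComb S)) ⟩
      0ℚ + 1ℚ * π5 pT S
        ≡⟨ trans (ℚP.+-identityˡ _) (ℚP.*-identityˡ _) ⟩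
      π5 pT S ∎
      where open ≡.≡-Reasoning

  pT∈EX5 : EX5 n (π5 pT)
  pT∈EX5 = pT , (pT.valid , pT.nonNegative , pT.total (shapeSize-comb Gir5 m)) , pT.exchangeable , λ _ _ → refl

proposition5p2 : (n : ℕ) → n ≥ 5 → IsVertex (EX5 n) (π5 (pShape n (Tn n)))
proposition5p2 n n≥5 with m , refl ← ℕP.m≤n⇒∃[o]m+o≡n n≥5 = subst (IsVertex (EX5 n) ∘ π5) pT≡ (pT∈EX5 , extremal)
  where
  open Vertex m hiding (n)
  extremal : (x y : Point) (λ′ : ℚ) → EX5 n x → EX5 n y → 0ℚ < λ′ → λ′ < 1ℚ →
             (∀ S → ValidL 5 S → π5 pT S ≡ λ′ * x S + (1ℚ - λ′) * y S) → (x ≈ₚ π5 pT) × (y ≈ₚ π5 pT)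
  extremal x y λ′ (Dx , (validx , 0≤Dx , totalx) , exchx , x≈) (Dy , (validy , 0≤Dy , totaly) , exchy , y≈) 0<λ′ λ′<1 split =
    (λ S vS → trans (x≈ S vS) (π5≡π5-pT decx (proj₁ α≡0) S)) , (λ S vS → trans (y≈ S vS) (π5≡π5-pT decy (proj₂ α≡0) S))
    where
    vanish-on-wide : ∀ S → ValidL 5 S → HasWideSplit S → x S ≡ 0ℚ × y S ≡ 0ℚ
    vanish-on-wide S vS w = convex-zero 0<λ′ λ′<1 (subst (0ℚ ≤_) (sym (x≈ S vS)) (measure-nonneg _ 0≤Dx))
      (subst (0ℚ ≤_) (sym (y≈ S vS)) (measure-nonneg _ 0≤Dy)) (trans (sym (split S vS)) (π5-pT-HasWideSplit w))
    decx : Decomposition Dx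
    decx = decompose (record { valid = validx ; nonNegative = 0≤Dx ; exchangeable = exchx
                             ; wideNull = λ S vS w → trans (sym (x≈ S vS)) (proj₁ (vanish-on-wide S vS w)) }) totalx
    decy : Decomposition Dy
    decy = decompose (record { valid = validy ; nonNegative = 0≤Dy ; exchangeable = exchy
                             ; wideNull = λ S vS w → trans (sym (y≈ S vS)) (proj₂ (vanish-on-wide S vS w)) }) totaly
    α≡0 : Decomposition.α decx ≡ 0ℚ × Decomposition.α decy ≡ 0ℚ
    α≡0 = convex-extreme 0<λ′ λ′<1 (Decomposition.0≤α decx) (Decomposition.0≤α decy) 0<π5-pT-G
      (trans (split G G-valid) (cong₂ (λ u v → λ′ * u + (1ℚ - λ′) * v) (trans (x≈ G G-valid) (π5-G decx)) (trans (y≈ G G-valid) (π5-G decy))))
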